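{- Let $m\ge3$ and $1\le p\le m-2$. Let $e=\{u,v,w_1,\dots,w_{m-2}\}$ be an edge and let $\mathcal{H}_1,\dots,\mathcal{H}_p$ be pairwise disjoint connected $m$-uniform hypergraphs (disjoint from $e$), each having at least one edge, with $\widetilde w_i\in V(\mathcal{H}_i)$ for $i\in[p]$. Let $\mathcal{H}$ be the hypergraph obtained from the single edge $e$ by attaching $\mathcal{H}_i$ with $\widetilde w_i$ identified with $w_i$ for each $i\in[p]$. For integers $r,s\ge0$ let $\mathcal{H}^e_{r,s}$ be obtained from $\mathcal{H}$ by attaching a hyperpath $P_r^{(m)}$ with one of its pendent vertices $\widetilde u$ identified with $u$ and a (disjoint) hyperpath $P_s^{(m)}$ with one of its pendent vertices $\widetilde v$ identified with $v$. If $r\ge s\ge1$, then $$N_{\mathcal{H}^e_{r,s}}(P_3^{(m)})>N_{\mathcal{H}^e_{r+s,0}}(P_3^{(m)}).$$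
   Context: For a graph $G$, the $m$-power hypergraph $G^{(m)}$ is obtained by adding $m-2$ new degree-one vertices to each edge of $G$. $P_q^{(m)}$ is the $m$-power of the path with $q$ edges; $P_0^{(m)}$ is a single vertex (so attaching $P_0^{(m)}$ adds nothing). A core vertex is a vertex of degree one; a pendent edge is an edge $e$ containing $|e|-1$ core vertices; a pendent vertex is a core vertex lying in a pendent edge (for $P_q^{(m)}$, $q\ge1$, a core vertex of an end edge). For hypergraphs $\mathcal{H}$ and $\widehat{\mathcal{H}}$, $N_{\mathcal{H}}(\widehat{\mathcal{H}})$ denotes the number of sub-hypergraphs of $\mathcal{H}$ isomorphic to $\widehat{\mathcal{H}}$. -}

module Defs where

open import Data.Nat using (ℕ; zero; suc; _+_; _*_; _∸_; _≤_; _<_; pred; _≤?_)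
open import Data.Nat.Properties using (≤-trans; +-monoʳ-≤; m∸n+n≡m)
open import Data.Bool using (Bool; true; false; _∧_)
open import Data.Fin using (Fin; toℕ; fromℕ<; _↑ˡ_; _↑ʳ_; punchOut; _≟_)
open import Data.Fin.Subset using (Subset; ⊤; ∣_∣) renaming (_∈_ to _∈ₛ_)
open import Data.Vec using (Vec; tabulate; _++_; replicate; lookup)
open import Data.List using (List; []; _∷_; length; map; allFin; upTo; _++_)
open import Data.Bool.ListAction using (any)
open import Data.List.Relation.Unary.All using (All)
open import Data.List.Relation.Unary.Unique.Propositional using (Unique)
open import Data.List.Membership.Propositional using () renaming (_∈_ to _∈ₗ_)
open import Data.Product using (Σ; ∃; _×_; _,_; proj₁; proj₂)
open import Data.Sum using (_⊎_)
open import Function using (id; _∘_)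
open import Function.Definitions using (Injective)
open import Relation.Binary.PropositionalEquality using (_≡_; refl)
open import Relation.Binary.Construct.Closure.ReflexiveTransitive using (Star)
open import Relation.Nullary.Decidable using (⌊_⌋; yes; no)

record Hypergraph : Set where
  constructor hg
  field
    nv    : ℕ
    edges : List (Subset nv)
open Hypergraph public

edgeAt : (H : Hypergraph) → Fin (length (edges H)) → Subset (nv H)
edgeAt H j = Data.List.lookup (edges H) j

Uniform : ℕ → Hypergraph → Set
Uniform m H = All (λ e → ∣ e ∣ ≡ m) (edges H)

Simple : Hypergraph → Set
Simple H = Unique (edges H)

HasEdge : Hypergraph → Set
HasEdge H = Σ (Subset (nv H)) λ e → e ∈ₗ edges H

Adj : (H : Hypergraph) → Fin (nv H) → Fin (nv H) → Set
Adj H x y = Σ (Subset (nv H)) λ e → e ∈ₗ edges H × x ∈ₛ e × y ∈ₛ e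

Connected : Hypergraph → Set
Connected H = ∀ x y → Star (Adj H) x y

record Rooted : Set where
  constructor rooted
  field
    graph : Hypergraph
    root  : Fin (nv graph)
open Rooted public

image : ∀ {n k} → (Fin n → Fin k) → Subset n → Subset k
image {n} f s = tabulate λ x → any (λ y → lookup s y ∧ ⌊ f y ≟ x ⌋) (allFin n)

-- Gluing: disjoint union of G and R, with (root R) identified with a.
-- Vertices of G keep their index (x ↦ x ↑ˡ _); the other vertices of R
-- are numbered after them.

glueMap : ∀ {n1 n2} → Fin n1 → Fin n2 → Fin n2 → Fin (n1 + pred n2)
glueMap {n1} {suc k} a b y with b ≟ y
... | yes _  = a ↑ˡ k
... | no b≢y = n1 ↑ʳ punchOut b≢y

glueAt : (G : Hypergraph) → Fin (nv G) → Rooted → Hypergraph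
glueAt G a R =
  hg (nv G + pred (nv (graph R)))
     (Data.List._++_ (map (λ e → Data.Vec._++_ e (replicate (pred (nv (graph R))) false)) (edges G))
                     (map (image (glueMap a (root R))) (edges (graph R))))

-- attach several rooted hypergraphs, each at a prescribed vertex
-- (given in some base type B, mapped into the current hypergraph by lift).
attachAll : ∀ {B : Set} (G : Hypergraph) → (B → Fin (nv G)) →
            List (B × Rooted) → Hypergraph
attachAll G lift [] = G
attachAll G lift ((t , R) ∷ rest) =
  attachAll (glueAt G (lift t) R) (λ b → lift b ↑ˡ pred (nv (graph R))) rest

-- The m-power hyperpath P_q^(m): vertices 0 .. q(m-1); edge j is
-- {j(m-1), ..., j(m-1)+(m-1)}.  For q = 0 it is a single vertex.

pathEdge : (m q j : ℕ) → Subset (suc (q * (m ∸ 1)))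
pathEdge m q j = tabulate λ x →
  ⌊ j * (m ∸ 1) ≤? toℕ x ⌋ ∧ ⌊ toℕ x ≤? j * (m ∸ 1) + (m ∸ 1) ⌋

Path : (m q : ℕ) → Hypergraph
Path m q = hg (suc (q * (m ∸ 1))) (map (pathEdge m q) (upTo q))

-- P_q^(m) rooted at a pendent vertex (vertex 0, a core vertex of the
-- first end edge; for q = 0 the unique vertex)
pathRoot : (m q : ℕ) → Fin (suc (q * (m ∸ 1)))
pathRoot m q = Data.Fin.zero

RootedPath : (m q : ℕ) → Rooted
RootedPath m q = rooted (Path m q) (pathRoot m q)

-- The single edge e = {u, v, w_1, ..., w_{m-2}} on vertex set Fin m,
-- with u = 0, v = 1, w_i = i + 1 (i = 1..p, here indexed by Fin p as 2 + i).

SingleEdge : ℕ → Hypergraph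
SingleEdge m = hg m (⊤ ∷ [])

data EdgePos (p : ℕ) : Set where
  posU : EdgePos p
  posV : EdgePos p
  posW : Fin p → EdgePos p

edgePos : ∀ {m p} → 3 ≤ m → p ≤ m ∸ 2 → EdgePos p → Fin m
edgePos {m} 3≤m p≤ posU = fromℕ< {0} (≤-trans (Data.Nat.s≤s Data.Nat.z≤n) 3≤m)
edgePos {m} 3≤m p≤ posV = fromℕ< {1} (≤-trans (Data.Nat.s≤s (Data.Nat.s≤s Data.Nat.z≤n)) 3≤m)
edgePos {m} {p} 3≤m p≤ (posW i) = fromℕ< {2 + toℕ i} lt
  where
  open import Data.Nat.Properties using (+-comm)
  open import Data.Fin.Properties using (toℕ<n)
  open import Relation.Binary.PropositionalEquality using (subst)
  lt : 2 + toℕ i < m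
  lt = subst (2 + toℕ i <_) (m∸n+n≡m-2)
         (subst (_< m ∸ 2 + 2) (+-comm (toℕ i) 2)
           (Data.Nat.Properties.+-monoˡ-< 2 (≤-trans (toℕ<n i) p≤)))
    where
    m∸n+n≡m-2 : m ∸ 2 + 2 ≡ m
    m∸n+n≡m-2 = m∸n+n≡m (≤-trans (Data.Nat.s≤s (Data.Nat.s≤s Data.Nat.z≤n)) 3≤m)

-- H^e_{r,s}: the edge e, with H_i attached at w_i (root of H_i = w̃_i),
-- P_r^(m) attached at u via a pendent vertex, P_s^(m) at v via a pendent vertex.
attachments : ∀ {p} → (Fin p → Rooted) → List (Fin p) → List (EdgePos p × Rooted)
attachments Hs [] = []
attachments Hs (i ∷ is) = (posW i , Hs i) ∷ attachments Hs is

Hers : (m : ℕ) → 3 ≤ m → (p : ℕ) → p ≤ m ∸ 2 → (Fin p → Rooted) → (r s : ℕ) → Hypergraph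
Hers m 3≤m p p≤ Hs r s =
  attachAll (SingleEdge m) (edgePos 3≤m p≤)
    ((posU , RootedPath m r) ∷ (posV , RootedPath m s) ∷ attachments Hs (allFin p))

-- Sub-hypergraphs and copies.
-- A sub-hypergraph of H is a vertex subset W together with a set S of
-- edges of H (given by their indices) such that every edge in S lies in W.

SubHG : Hypergraph → Set
SubHG H = Subset (nv H) × Subset (length (edges H))

IsSubHG : (H : Hypergraph) → SubHG H → Set
IsSubHG H (W , S) = ∀ j → j ∈ₛ S → ∀ x → x ∈ₛ edgeAt H j → x ∈ₛ W

infix 2 _⇔_
_⇔_ : Set → Set → Set
A ⇔ B = (A → B) × (B → A)

MapsEdge : ∀ {k n} → (Fin k → Fin n) → Subset k → Subset n → Set
MapsEdge φ f e = ∀ x → x ∈ₛ e ⇔ (Σ _ λ y → y ∈ₛ f × φ y ≡ x)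

IsCopy : (F H : Hypergraph) → SubHG H → Set
IsCopy F H (W , S) =
  IsSubHG H (W , S) ×
  Σ (Fin (nv F) → Fin (nv H)) λ φ →
    Injective _≡_ _≡_ φ ×
    (∀ x → x ∈ₛ W ⇔ (Σ _ λ y → φ y ≡ x)) ×
    (∀ j → j ∈ₛ S → Σ (Subset (nv F)) λ f → f ∈ₗ edges F × MapsEdge φ f (edgeAt H j)) ×
    (∀ f → f ∈ₗ edges F → Σ _ λ j → j ∈ₛ S × MapsEdge φ f (edgeAt H j))

-- N_H(F) = k : the sub-hypergraphs of H isomorphic to F are exactly the
-- entries of a duplicate-free list of length k.
NumCopies : (H F : Hypergraph) → ℕ → Set
NumCopies H F k =
  Σ (List (SubHG H)) λ L → Unique L × (∀ X → X ∈ₗ L ⇔ IsCopy F H X) × length L ≡ k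

{-# OPTIONS --safe #-}
-- Lay H^e_{r,s} and H^e_{r+s,0} out on the same vertices.  They then share every edge except one:
-- the (r + 1)-st edge ε of the path at u in H^e_{r+s,0}, which H^e_{r,s} replaces by the first edge
-- of its path at v.  Copies of P₃ avoiding ε are copies in H^e_{r,s}.  A copy through ε lies within
-- two edges of ε; folding the path at u at position r k (its r-th edge onto e, the earlier edges
-- reflected, ε onto the first edge at v) carries it injectively to a copy in H^e_{r,s} that uses no
-- attached edge.  Neither kind reaches the copy formed by the first edge at v, e and an edge of H₁
-- through w₁, so N(P₃) strictly drops from H^e_{r,s} to H^e_{r+s,0}.
module Submission where

open import Defs
open import Data.Nat using (ℕ; zero; suc; _+_; _*_; _∸_; _≤_; _<_; z≤n; s≤s; s≤s⁻¹; _≤?_; _<?_; pred; NonZero; ≢-nonZero)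
import Data.Nat as ℕ
open import Data.Nat.Properties hiding (_≟_)
open import Data.Bool using (Bool; true; false; T; _∧_)
open import Data.Bool.Properties using (T-∧)
import Data.Bool.Properties as Boolₚ
open import Data.Empty using (⊥-elim)
import Data.Unit
open import Data.Unit using (tt)
open import Data.Fin using (Fin; toℕ; fromℕ<; _↑ˡ_; _≟_; punchOut) renaming (zero to fzero; suc to fsuc)
open import Data.Fin.Properties using (toℕ-fromℕ<; toℕ<n; toℕ-injective; toℕ-↑ˡ; toℕ-↑ʳ; ↑ʳ-injective; punchOut-injective)
import Data.Fin.Properties as Finₚ
open import Data.Fin.Subset using (Subset; ⊤; _⊆_; ∣_∣; Nonempty) renaming (_∈_ to _∈ₛ_)
open import Data.Fin.Subset.Properties using (∈⊤; ∉⊥; ⊆-antisym; _∈?_; nonempty?; Empty-unique; ∣⊥∣≡0)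
open import Data.Vec using ([]; _∷_; here; there; replicate) renaming (_++_ to _++ᵥ_)
import Data.Vec as Vec
open import Data.Vec.Properties using (lookup∘tabulate)
import Data.Vec.Properties as Vecₚ
open import Data.List
  using (List; []; _∷_; [_]; length; map; _++_; lookup; allFin; upTo; applyUpTo; drop; filter; deduplicate; cartesianProduct)
open import Data.List.Properties using (length-map; length-++; length-upTo; map-++; map-∘; ++-identityʳ; map-id; ++-assoc)
open import Data.List.Membership.Propositional using (find; lose) renaming (_∈_ to _∈ₗ_; _∉_ to _∉ₗ_)
open import Data.List.Membership.Propositional.Properties
  using (∈-allFin; ∈-lookup; ∈-∃++; ∈-++⁺ˡ; ∈-++⁺ʳ; ∈-++⁻; ∈-map⁺; ∈-map⁻;
         ∈-filter⁺; ∈-filter⁻; ∈-deduplicate⁺; ∈-deduplicate⁻; ∈-cartesianProduct⁺)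
open import Data.List.Relation.Binary.Subset.Propositional using () renaming (_⊆_ to _⊆ₗ_)
open import Data.List.Relation.Unary.Any using (here; there; satisfied)
import Data.List.Relation.Unary.Any as Any
open import Data.List.Relation.Unary.Any.Properties using (any⁻; any⁺; lookup-index)
import Data.List.Relation.Unary.All as All
open import Data.List.Relation.Unary.AllPairs using ([]; _∷_)
open import Data.List.Relation.Unary.Unique.Propositional using (Unique)
import Data.List.Relation.Unary.Unique.Propositional.Properties as Uniqueₚ
import Data.List.Relation.Unary.Unique.DecPropositional.Properties as DecUniqueₚ
open import Data.Maybe using (Maybe; just; nothing; fromMaybe)
import Data.Maybe as Maybe
open import Data.Maybe.Properties using (just-injective)
open import Data.Product using (Σ; ∃-syntax; _×_; _,_; proj₁; proj₂)
import Data.Product.Properties as Productₚ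
open import Data.Sum using (_⊎_; inj₁; inj₂)
open import Function using (id; _∘_)
open import Function.Bundles using (Equivalence)
open import Function.Definitions using (Injective)
open import Relation.Binary.Definitions using (DecidableEquality)
import Relation.Binary.Construct.Closure.ReflexiveTransitive as Star
open import Relation.Binary.PropositionalEquality using (_≡_; _≢_; refl; sym; trans; cong; cong₂; subst; module ≡-Reasoning)
open import Relation.Nullary using (¬_; Dec; yes; no; contradiction)
open import Relation.Nullary.Decidable using (⌊_⌋; toWitness; fromWitness; _×-dec_; _→-dec_; map′)

private
  variable
    X Y : Set
    n₁ n₂ n₃ : ℕ

-- Copies and their number

⇔-trans : ∀ {P Q R : Set} → P ⇔ Q → Q ⇔ R → P ⇔ R
⇔-trans (f , g) (f' , g') = f' ∘ f , g ∘ g'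

⇔-sym : ∀ {P Q : Set} → P ⇔ Q → Q ⇔ P
⇔-sym (f , g) = g , f

_⇔-dec_ : ∀ {P Q : Set} → Dec P → Dec Q → Dec (P ⇔ Q)
p? ⇔-dec q? = (p? →-dec q?) ×-dec (q? →-dec p?)

∈⇒T : ∀ {x : Fin n₁} {s : Subset n₁} → x ∈ₛ s → T (Vec.lookup s x)
∈⇒T here = _
∈⇒T (there x∈) = ∈⇒T x∈

T⇒∈ : ∀ (x : Fin n₁) (s : Subset n₁) → T (Vec.lookup s x) → x ∈ₛ s
T⇒∈ fzero (true ∷ s) _ = here
T⇒∈ (fsuc x) (_ ∷ s) t = there (T⇒∈ x s t)

∈-tabulate⁻ : ∀ (p : Fin n₁ → Bool) {x} → x ∈ₛ Vec.tabulate p → T (p x)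
∈-tabulate⁻ p {x} x∈ = subst T (lookup∘tabulate p x) (∈⇒T x∈)

∈-tabulate⁺ : ∀ (p : Fin n₁ → Bool) {x} → T (p x) → x ∈ₛ Vec.tabulate p
∈-tabulate⁺ p {x} t = T⇒∈ x (Vec.tabulate p) (subst T (sym (lookup∘tabulate p x)) t)

∈-image⁻ : (f : Fin n₁ → Fin n₂) (s : Subset n₁) {x : Fin n₂} →
           x ∈ₛ image f s → ∃[ y ] y ∈ₛ s × f y ≡ x
∈-image⁻ {n} f s {x} x∈ with satisfied (any⁻ _ (allFin n) (∈-tabulate⁻ _ x∈))
... | y , Ty with Equivalence.to (T-∧ {Vec.lookup s y}) Ty
... | y∈s , fy≡x = y , T⇒∈ y s y∈s , toWitness fy≡x

∈-image⁺ : (f : Fin n₁ → Fin n₂) (s : Subset n₁) {y : Fin n₁} → y ∈ₛ s → f y ∈ₛ image f s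
∈-image⁺ {n} f s {y} y∈ = ∈-tabulate⁺ _ (any⁺ _ (lose (∈-allFin y)
  (Equivalence.from (T-∧ {Vec.lookup s y}) (∈⇒T y∈ , fromWitness refl))))

image-injective : (f : Fin n₁ → Fin n₂) (P : Fin n₁ → Set) →
  (∀ {y y'} → P y → P y' → f y ≡ f y' → y ≡ y') →
  ∀ {W W'} → (∀ {y} → y ∈ₛ W → P y) → (∀ {y} → y ∈ₛ W' → P y) →
  image f W ≡ image f W' → W ≡ W'
image-injective f P f-inj {W} {W'} W⊆P W'⊆P fW≡fW' =
  ⊆-antisym (⊆-from W⊆P W'⊆P fW≡fW') (⊆-from W'⊆P W⊆P (sym fW≡fW'))
  where
  ⊆-from : ∀ {U U'} → (∀ {y} → y ∈ₛ U → P y) → (∀ {y} → y ∈ₛ U' → P y) →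
           image f U ≡ image f U' → U ⊆ U'
  ⊆-from {U} {U'} U⊆P U'⊆P eq {y} y∈ with ∈-image⁻ f U' (subst (f y ∈ₛ_) eq (∈-image⁺ f U y∈))
  ... | y' , y'∈ , fy'≡fy = subst (_∈ₛ U') (f-inj (U'⊆P y'∈) (U⊆P y∈) fy'≡fy) y'∈

MapsEdge-∘ : (φ : Fin n₁ → Fin n₂) (ψ : Fin n₂ → Fin n₃) {f : Subset n₁} {e : Subset n₂} {g : Subset n₃} →
  MapsEdge φ f e → MapsEdge ψ e g → MapsEdge (ψ ∘ φ) f g
MapsEdge-∘ φ ψ {f} {e} {g} φfe ψeg x = to , from
  where
  to : x ∈ₛ g → ∃[ y ] y ∈ₛ f × ψ (φ y) ≡ x
  to x∈g with proj₁ (ψeg x) x∈g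
  ... | z , z∈e , ψz≡x with proj₁ (φfe z) z∈e
  ... | y , y∈f , φy≡z = y , y∈f , trans (cong ψ φy≡z) ψz≡x
  from : (∃[ y ] y ∈ₛ f × ψ (φ y) ≡ x) → x ∈ₛ g
  from (y , y∈f , ψφy≡x) = proj₂ (ψeg x) (φ y , proj₂ (φfe (φ y)) (y , y∈f , refl) , ψφy≡x)

MapsEdge-cong : {φ ψ : Fin n₁ → Fin n₂} → (∀ x → φ x ≡ ψ x) →
  ∀ {f e} → MapsEdge φ f e → MapsEdge ψ f e
MapsEdge-cong φ≗ψ φfe x =
  (λ x∈e → let (y , y∈f , φy≡x) = proj₁ (φfe x) x∈e in y , y∈f , trans (sym (φ≗ψ y)) φy≡x) ,
  (λ { (y , y∈f , ψy≡x) → proj₂ (φfe x) (y , y∈f , trans (φ≗ψ y) ψy≡x) })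

MapsEdge-id : {e e' : Subset n₁} → (∀ x → x ∈ₛ e' ⇔ x ∈ₛ e) → MapsEdge id e e'
MapsEdge-id e'⇔e x = (λ x∈e' → x , proj₁ (e'⇔e x) x∈e' , refl) , λ { (y , y∈e , refl) → proj₂ (e'⇔e y) y∈e }

IsCopy-map : (F A B : Hypergraph) {W : Subset (nv A)} {S : Subset (length (edges A))}
  (ψ : Fin (nv A) → Fin (nv B)) (σ : Fin (length (edges A)) → Fin (length (edges B))) →
  (∀ {y y'} → y ∈ₛ W → y' ∈ₛ W → ψ y ≡ ψ y' → y ≡ y') →
  (∀ {j} → j ∈ₛ S → MapsEdge ψ (edgeAt A j) (edgeAt B (σ j))) →
  IsCopy F A (W , S) → IsCopy F B (image ψ W , image σ S)
IsCopy-map F A B {W} {S} ψ σ ψ-inj σ-maps (sub , φ , φ-inj , W≡φ , S⇒F , F⇒S) =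
  sub' , ψ ∘ φ , ψφ-inj , W'≡ψφ , S'⇒F , F⇒S'
  where
  φ∈W : ∀ a → φ a ∈ₛ W
  φ∈W a = proj₂ (W≡φ (φ a)) (a , refl)
  sub' : IsSubHG B (image ψ W , image σ S)
  sub' j' j'∈ x x∈ with ∈-image⁻ σ S j'∈
  ... | j , j∈ , refl with proj₁ (σ-maps j∈ x) x∈
  ... | y , y∈ , refl = ∈-image⁺ ψ W (sub j j∈ y y∈)
  ψφ-inj : Injective _≡_ _≡_ (ψ ∘ φ)
  ψφ-inj {a} {b} eq = φ-inj (ψ-inj (φ∈W a) (φ∈W b) eq)
  W'≡ψφ : ∀ x → x ∈ₛ image ψ W ⇔ (Σ _ λ y → ψ (φ y) ≡ x)
  W'≡ψφ x = to , λ { (y , refl) → ∈-image⁺ ψ W (φ∈W y) }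
    where
    to : x ∈ₛ image ψ W → ∃[ y ] ψ (φ y) ≡ x
    to x∈ with ∈-image⁻ ψ W x∈
    ... | z , z∈ , ψz≡x with proj₁ (W≡φ z) z∈
    ... | y , refl = y , ψz≡x
  S'⇒F : ∀ j → j ∈ₛ image σ S → Σ (Subset (nv F)) λ f → f ∈ₗ edges F × MapsEdge (ψ ∘ φ) f (edgeAt B j)
  S'⇒F j' j'∈ with ∈-image⁻ σ S j'∈
  ... | j , j∈ , refl with S⇒F j j∈
  ... | f , f∈ , φfj = f , f∈ , MapsEdge-∘ φ ψ φfj (σ-maps j∈)
  F⇒S' : ∀ f → f ∈ₗ edges F → Σ _ λ j → j ∈ₛ image σ S × MapsEdge (ψ ∘ φ) f (edgeAt B j)
  F⇒S' f f∈ with F⇒S f f∈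
  ... | j , j∈ , φfj = σ j , ∈-image⁺ σ S j∈ , MapsEdge-∘ φ ψ φfj (σ-maps j∈)

IsCopy-self : (H : Hypergraph) → IsCopy H H (⊤ , ⊤)
IsCopy-self H =
  (λ _ _ _ _ → ∈⊤) , id , id , (λ x → (λ _ → x , refl) , (λ _ → ∈⊤)) ,
  (λ j _ → edgeAt H j , ∈-lookup j , MapsEdge-id (λ _ → id , id)) ,
  λ f f∈ → Any.index f∈ , ∈⊤ , subst (MapsEdge id f) (lookup-index f∈) (MapsEdge-id (λ _ → id , id))

private
  cons : Fin n₁ → (Fin n₂ → Fin n₁) → Fin (suc n₂) → Fin n₁
  cons a g fzero = a
  cons a g (fsuc i) = g i

∃-function? : (P : (Fin n₂ → Fin n₁) → Set) → (∀ {φ ψ} → (∀ x → φ x ≡ ψ x) → P φ → P ψ) →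
              (∀ φ → Dec (P φ)) → Dec (Σ _ P)
∃-function? {zero} P P-ext P? = map′ (λ p → _ , p) (λ (φ , p) → P-ext (λ ()) p) (P? λ ())
∃-function? {suc k} P P-ext P? =
  map′ (λ (a , g , p) → cons a g , p)
       (λ (φ , p) → φ fzero , φ ∘ fsuc , P-ext (λ { fzero → refl ; (fsuc i) → refl }) p)
       (Finₚ.any? λ a → ∃-function? (P ∘ cons a)
          (λ g≗h → P-ext (λ { fzero → refl ; (fsuc i) → g≗h i })) (P? ∘ cons a))

private
  ∃-∈? : ∀ {A : Set} {P : A → Set} (xs : List A) → (∀ x → Dec (P x)) → Dec (Σ A λ x → x ∈ₗ xs × P x)
  ∃-∈? xs P? = map′ find (λ (x , x∈ , p) → lose x∈ p) (Any.any? P? xs)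

  ∀-∈? : ∀ {A : Set} {P : A → Set} (xs : List A) → (∀ x → Dec (P x)) → Dec (∀ x → x ∈ₗ xs → P x)
  ∀-∈? xs P? = map′ (λ ps x x∈ → All.lookup ps x∈) (λ h → All.tabulate (h _)) (All.all? P? xs)

MapsEdge? : (φ : Fin n₁ → Fin n₂) (f : Subset n₁) (e : Subset n₂) → Dec (MapsEdge φ f e)
MapsEdge? φ f e = Finₚ.all? λ x → (x ∈? e) ⇔-dec Finₚ.any? (λ y → (y ∈? f) ×-dec (φ y ≟ x))

private
  CopyMap : (F H : Hypergraph) → SubHG H → (Fin (nv F) → Fin (nv H)) → Set
  CopyMap F H (W , S) φ =
    Injective _≡_ _≡_ φ ×
    (∀ x → x ∈ₛ W ⇔ (Σ _ λ y → φ y ≡ x)) ×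
    (∀ j → j ∈ₛ S → Σ (Subset (nv F)) λ f → f ∈ₗ edges F × MapsEdge φ f (edgeAt H j)) ×
    (∀ f → f ∈ₗ edges F → Σ _ λ j → j ∈ₛ S × MapsEdge φ f (edgeAt H j))

IsCopy? : (F H : Hypergraph) (X : SubHG H) → Dec (IsCopy F H X)
IsCopy? F H (W , S) =
  (Finₚ.all? λ j → (j ∈? S) →-dec Finₚ.all? λ x → (x ∈? edgeAt H j) →-dec (x ∈? W))
  ×-dec ∃-function? (CopyMap F H (W , S)) ext (λ φ →
          map′ (λ h {x} {y} → h x y) (λ h x y → h {x} {y})
               (Finₚ.all? λ x → Finₚ.all? λ y → (φ x ≟ φ y) →-dec (x ≟ y))
    ×-dec (Finₚ.all? λ x → (x ∈? W) ⇔-dec Finₚ.any? (λ y → φ y ≟ x))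
    ×-dec (Finₚ.all? λ j → (j ∈? S) →-dec ∃-∈? (edges F) (λ f → MapsEdge? φ f (edgeAt H j)))
    ×-dec ∀-∈? (edges F) (λ f → Finₚ.any? λ j → (j ∈? S) ×-dec MapsEdge? φ f (edgeAt H j)))
  where
  ext : ∀ {φ ψ} → (∀ x → φ x ≡ ψ x) → CopyMap F H (W , S) φ → CopyMap F H (W , S) ψ
  ext φ≗ψ (inj , W≡φ , S⇒F , F⇒S) =
    (λ {x} {y} eq → inj (trans (φ≗ψ x) (trans eq (sym (φ≗ψ y))))) ,
    (λ x → (λ x∈ → let (y , eq) = proj₁ (W≡φ x) x∈ in y , trans (sym (φ≗ψ y)) eq) ,
           (λ { (y , eq) → proj₂ (W≡φ x) (y , trans (φ≗ψ y) eq) })) ,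
    (λ j j∈ → let (f , f∈ , φfe) = S⇒F j j∈ in f , f∈ , MapsEdge-cong φ≗ψ φfe) ,
    (λ f f∈ → let (j , j∈ , φfe) = F⇒S f f∈ in j , j∈ , MapsEdge-cong φ≗ψ φfe)

allSubsets : ∀ n → List (Subset n)
allSubsets zero = [ [] ]
allSubsets (suc n) = map (true ∷_) (allSubsets n) ++ map (false ∷_) (allSubsets n)

∈-allSubsets : (s : Subset n₁) → s ∈ₗ allSubsets n₁
∈-allSubsets [] = here refl
∈-allSubsets (true ∷ s) = ∈-++⁺ˡ (∈-map⁺ (true ∷_) (∈-allSubsets s))
∈-allSubsets {suc n} (false ∷ s) = ∈-++⁺ʳ (map (true ∷_) (allSubsets n)) (∈-map⁺ (false ∷_) (∈-allSubsets s))

private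
  SubHG-≟ : (H : Hypergraph) → DecidableEquality (SubHG H)
  SubHG-≟ H = Productₚ.≡-dec (Vecₚ.≡-dec Boolₚ._≟_) (Vecₚ.≡-dec Boolₚ._≟_)

allSubHGs : (H : Hypergraph) → List (SubHG H)
allSubHGs H = cartesianProduct (allSubsets _) (allSubsets _)

copies : (H F : Hypergraph) → List (SubHG H)
copies H F = deduplicate (SubHG-≟ H) (filter (IsCopy? F H) (allSubHGs H))

∈-copies : (H F : Hypergraph) (X : SubHG H) → X ∈ₗ copies H F ⇔ IsCopy F H X
∈-copies H F (W , S) =
  (λ X∈ → proj₂ (∈-filter⁻ (IsCopy? F H) {xs = allSubHGs H} (∈-deduplicate⁻ (SubHG-≟ H) _ X∈))) ,
  (λ X-copy → ∈-deduplicate⁺ (SubHG-≟ H)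
     (∈-filter⁺ (IsCopy? F H) (∈-cartesianProduct⁺ (∈-allSubsets W) (∈-allSubsets S)) X-copy))

numCopies : (H F : Hypergraph) → NumCopies H F (length (copies H F))
numCopies H F = copies H F , DecUniqueₚ.deduplicate-! (SubHG-≟ H) _ , ∈-copies H F , refl

private
  ∉⇒All≢ : ∀ {A : Set} {z : A} xs → z ∉ₗ xs → All.All (z ≢_) xs
  ∉⇒All≢ [] _ = All.[]
  ∉⇒All≢ (x ∷ xs) z∉ = (λ z≡x → z∉ (here z≡x)) All.∷ ∉⇒All≢ xs (z∉ ∘ there)

length-mono-⊆ : ∀ {A : Set} {xs ys : List A} → Unique xs → xs ⊆ₗ ys → length xs ≤ length ys
length-mono-⊆ {xs = []} _ _ = z≤n
length-mono-⊆ {xs = x ∷ xs} (x∉xs ∷ xs!) xs⊆ys with ∈-∃++ (xs⊆ys (here refl))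
... | ys₁ , ys₂ , refl = begin
  suc (length xs)                  ≤⟨ s≤s (length-mono-⊆ xs! xs⊆ys₁ys₂) ⟩
  suc (length (ys₁ ++ ys₂))        ≡⟨ cong suc (length-++ ys₁) ⟩
  suc (length ys₁ + length ys₂)    ≡⟨ sym (+-suc (length ys₁) (length ys₂)) ⟩
  length ys₁ + length (x ∷ ys₂)    ≡⟨ sym (length-++ ys₁) ⟩
  length (ys₁ ++ x ∷ ys₂)          ∎
  where
  open ≤-Reasoning
  xs⊆ys₁ys₂ : xs ⊆ₗ ys₁ ++ ys₂
  xs⊆ys₁ys₂ {z} z∈ with ∈-++⁻ ys₁ (xs⊆ys (there z∈))
  ... | inj₁ z∈ys₁ = ∈-++⁺ˡ z∈ys₁
  ... | inj₂ (here refl) = contradiction refl (All.lookup x∉xs z∈)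
  ... | inj₂ (there z∈ys₂) = ∈-++⁺ʳ ys₁ z∈ys₂

length-mono-⊂ : ∀ {A : Set} {xs ys : List A} {z : A} → Unique xs → xs ⊆ₗ ys →
                z ∈ₗ ys → z ∉ₗ xs → length xs < length ys
length-mono-⊂ {xs = xs} xs! xs⊆ys z∈ys z∉xs =
  length-mono-⊆ (∉⇒All≢ xs z∉xs ∷ xs!) λ { (here refl) → z∈ys ; (there x∈) → xs⊆ys x∈ }

copies-< : (F A B : Hypergraph) (g : SubHG B → SubHG A) →
  (∀ {X} → IsCopy F B X → IsCopy F A (g X)) →
  (∀ {X X'} → IsCopy F B X → IsCopy F B X' → g X ≡ g X' → X ≡ X') →
  (Z : SubHG A) → IsCopy F A Z → (∀ {X} → IsCopy F B X → g X ≢ Z) →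
  length (copies B F) < length (copies A F)
copies-< F A B g g-copy g-inj Z Z-copy Z-missed =
  subst (_< length (copies A F)) (length-map g (copies B F))
    (length-mono-⊂ (map-unique isCopyB (proj₁ (proj₂ (numCopies B F)))) g[B]⊆A
       (proj₂ (∈-copies A F Z) Z-copy) Z∉g[B])
  where
  isCopyB : ∀ {X} → X ∈ₗ copies B F → IsCopy F B X
  isCopyB = proj₁ (∈-copies B F _)
  map-unique : ∀ {Xs} → (∀ {X} → X ∈ₗ Xs → IsCopy F B X) → Unique Xs → Unique (map g Xs)
  map-unique {[]} _ [] = []
  map-unique {X ∷ Xs} copy (X∉ ∷ Xs!) =
    All.tabulate gX∉ ∷ map-unique (copy ∘ there) Xs!
    where
    gX∉ : ∀ {Y'} → Y' ∈ₗ map g Xs → g X ≢ Y'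
    gX∉ Y'∈ with ∈-map⁻ g Y'∈
    ... | Y , Y∈ , refl = λ gX≡gY → All.lookup X∉ Y∈ (g-inj (copy (here refl)) (copy (there Y∈)) gX≡gY)
  g[B]⊆A : map g (copies B F) ⊆ₗ copies A F
  g[B]⊆A Y∈ with ∈-map⁻ g Y∈
  ... | X , X∈ , refl = proj₂ (∈-copies A F (g X)) (g-copy (isCopyB X∈))
  Z∉g[B] : Z ∉ₗ map g (copies B F)
  Z∉g[B] Z∈ with ∈-map⁻ g Z∈
  ... | X , X∈ , Z≡gX = Z-missed (isCopyB X∈) (sym Z≡gX)

Meet : ∀ {n} → Subset n → Subset n → Set
Meet e f = ∃[ x ] x ∈ₛ e × x ∈ₛ f

module _ (m q j : ℕ) (x : Fin (suc (q * (m ∸ 1)))) where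
  private
    k : ℕ
    k = m ∸ 1
    lo? : Dec (j * k ≤ toℕ x)
    lo? = j * k ≤? toℕ x
    hi? : Dec (toℕ x ≤ j * k + k)
    hi? = toℕ x ≤? j * k + k

  ∈-pathEdge⁻ : x ∈ₛ pathEdge m q j → j * k ≤ toℕ x × toℕ x ≤ j * k + k
  ∈-pathEdge⁻ x∈ with Equivalence.to (T-∧ {⌊ lo? ⌋} {⌊ hi? ⌋}) (∈-tabulate⁻ (λ x → ⌊ j * k ≤? toℕ x ⌋ ∧ ⌊ toℕ x ≤? j * k + k ⌋) x∈)
  ... | lo , hi = toWitness {a? = lo?} lo , toWitness {a? = hi?} hi

  ∈-pathEdge⁺ : j * k ≤ toℕ x → toℕ x ≤ j * k + k → x ∈ₛ pathEdge m q j
  ∈-pathEdge⁺ lo hi = ∈-tabulate⁺ (λ x → ⌊ j * k ≤? toℕ x ⌋ ∧ ⌊ toℕ x ≤? j * k + k ⌋)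
    (Equivalence.from (T-∧ {⌊ lo? ⌋} {⌊ hi? ⌋}) (fromWitness lo , fromWitness hi))

module _ (m : ℕ) where
  private
    k : ℕ
    k = m ∸ 1
    V : Set
    V = Fin (suc (3 * k))

    vertex : ∀ c → c ≤ 3 * k → V
    vertex c c≤ = fromℕ< (s≤s c≤)

    ∈-P₃-edge : ∀ j c (c≤ : c ≤ 3 * k) → j * k ≤ c → c ≤ j * k + k → vertex c c≤ ∈ₛ pathEdge m 3 j
    ∈-P₃-edge j c c≤ lo hi = ∈-pathEdge⁺ m 3 j _
      (subst (j * k ≤_) (sym (toℕ-fromℕ< _)) lo) (subst (_≤ j * k + k) (sym (toℕ-fromℕ< _)) hi)

    k≤3k : k ≤ 3 * k
    k≤3k = m≤m+n k _

    2k≤3k : 2 * k ≤ 3 * k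
    2k≤3k = *-monoˡ-≤ k (n≤1+n 2)

  -- Consecutive edges of P₃ share the vertices k and 2k.
  P₃-meets-middle : ∀ {f} → f ∈ₗ edges (Path m 3) → Meet f (pathEdge m 3 1)
  P₃-meets-middle (here refl) =
    vertex k k≤3k , ∈-P₃-edge 0 k k≤3k z≤n ≤-refl , ∈-P₃-edge 1 k k≤3k (≤-reflexive (*-identityˡ k)) (m≤n+m k (1 * k))
  P₃-meets-middle (there (here refl)) =
    vertex k k≤3k , ∈-P₃-edge 1 k k≤3k (≤-reflexive (*-identityˡ k)) (m≤n+m k (1 * k)) ,
                    ∈-P₃-edge 1 k k≤3k (≤-reflexive (*-identityˡ k)) (m≤n+m k (1 * k))
  P₃-meets-middle (there (there (here refl))) =
    vertex (2 * k) 2k≤3k , ∈-P₃-edge 2 (2 * k) 2k≤3k ≤-refl (m≤m+n (2 * k) k) ,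
                           ∈-P₃-edge 1 (2 * k) 2k≤3k (*-monoˡ-≤ k (n≤1+n 1)) (≤-reflexive (+-comm k (k + 0)))

  P₃-covered : ∀ (y : V) → ∃[ f ] f ∈ₗ edges (Path m 3) × y ∈ₛ f
  P₃-covered y with toℕ y ≤? 1 * k | toℕ y ≤? 2 * k
  ... | yes y≤k | _ = _ , here refl , ∈-pathEdge⁺ m 3 0 y z≤n (subst (toℕ y ≤_) (+-identityʳ k) y≤k)
  ... | no y≰k | yes y≤2k = _ , there (here refl) ,
    ∈-pathEdge⁺ m 3 1 y (<⇒≤ (≰⇒> y≰k)) (subst (toℕ y ≤_) (+-comm k (k + 0)) y≤2k)
  ... | no _ | no y≰2k = _ , there (there (here refl)) ,
    ∈-pathEdge⁺ m 3 2 y (<⇒≤ (≰⇒> y≰2k)) (≤-trans (s≤s⁻¹ (toℕ<n y)) (≤-reflexive 3k≡2k+k))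
    where
    3k≡2k+k : 3 * k ≡ 2 * k + k
    3k≡2k+k = trans (cong (k +_) (+-comm k (k + 0))) (sym (+-assoc k (k + 0) k))

  module _ (A : Hypergraph) {W : Subset (nv A)} {S : Subset (length (edges A))} where

    copy-linked : IsCopy (Path m 3) A (W , S) → ∀ {j j'} → j ∈ₛ S → j' ∈ₛ S →
      ∃[ j'' ] j'' ∈ₛ S × Meet (edgeAt A j) (edgeAt A j'') × Meet (edgeAt A j'') (edgeAt A j')
    copy-linked (_ , φ , _ , _ , S⇒P₃ , P₃⇒S) {j} {j'} j∈ j'∈ with S⇒P₃ j j∈ | S⇒P₃ j' j'∈ | P₃⇒S (pathEdge m 3 1) (there (here refl))
    ... | f , f∈ , φfj | f' , f'∈ , φf'j' | j'' , j''∈ , φ1j'' with P₃-meets-middle f∈ | P₃-meets-middle f'∈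
    ... | y , y∈f , y∈1 | y' , y'∈f' , y'∈1 =
      j'' , j''∈ ,
      (φ y , proj₂ (φfj (φ y)) (y , y∈f , refl) , proj₂ (φ1j'' (φ y)) (y , y∈1 , refl)) ,
      (φ y' , proj₂ (φ1j'' (φ y')) (y' , y'∈1 , refl) , proj₂ (φf'j' (φ y')) (y' , y'∈f' , refl))

    copy-covered : IsCopy (Path m 3) A (W , S) → ∀ {x} → x ∈ₛ W → ∃[ j ] j ∈ₛ S × x ∈ₛ edgeAt A j
    copy-covered (_ , φ , _ , W≡φ , _ , P₃⇒S) {x} x∈ with proj₁ (W≡φ x) x∈
    ... | y , refl with P₃-covered y
    ... | f , f∈ , y∈f with P₃⇒S f f∈
    ... | j , j∈ , φfj = j , j∈ , proj₂ (φfj (φ y)) (y , y∈f , refl)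

-- Gluing

pad : ∀ k → Subset n₁ → Subset (n₁ + k)
pad k e = e ++ᵥ replicate k false

∈-pad⁺ : {e : Subset n₁} {y : Fin n₁} → y ∈ₛ e → y ↑ˡ n₂ ∈ₛ pad n₂ e
∈-pad⁺ here = here
∈-pad⁺ (there y∈) = there (∈-pad⁺ y∈)

∈-pad⁻ : (e : Subset n₁) {x : Fin (n₁ + n₂)} → x ∈ₛ pad n₂ e → ∃[ y ] y ∈ₛ e × y ↑ˡ n₂ ≡ x
∈-pad⁻ [] x∈ = contradiction x∈ ∉⊥
∈-pad⁻ (_ ∷ e) {fzero} here = fzero , here , refl
∈-pad⁻ (_ ∷ e) {fsuc x} (there x∈) with ∈-pad⁻ e x∈
... | y , y∈ , refl = fsuc y , there y∈ , refl

toℕ-glueMap-root : ∀ {n₁ n₂} (a : Fin n₁) (b : Fin n₂) → toℕ (glueMap a b b) ≡ toℕ a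
toℕ-glueMap-root {n₂ = suc _} a b with b ≟ b
... | yes _ = toℕ-↑ˡ a _
... | no b≢b = contradiction refl b≢b

toℕ-glueMap-other : ∀ {n₁ n₂} (a : Fin n₁) (b : Fin n₂) {y} → b ≢ y → n₁ ≤ toℕ (glueMap a b y)
toℕ-glueMap-other {n₁} {suc _} a b {y} b≢y with b ≟ y
... | yes b≡y = contradiction b≡y b≢y
... | no b≢y = subst (n₁ ≤_) (sym (toℕ-↑ʳ n₁ (punchOut b≢y))) (m≤m+n n₁ _)

glueMap-injective : ∀ {n₁ n₂} (a : Fin n₁) (b : Fin n₂) {y y'} → glueMap a b y ≡ glueMap a b y' → y ≡ y'
glueMap-injective {n₁} {suc _} a b {y} {y'} eq with b ≟ y | b ≟ y'
... | yes b≡y | yes b≡y' = trans (sym b≡y) b≡y'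
... | yes _ | no b≢y' = contradiction (subst (n₁ ≤_) (sym (cong toℕ eq)) (subst (n₁ ≤_) (sym (toℕ-↑ʳ n₁ _)) (m≤m+n n₁ _)))
                                      (<⇒≱ (subst (_< n₁) (sym (toℕ-↑ˡ a _)) (toℕ<n a)))
... | no b≢y | yes _ = contradiction (subst (n₁ ≤_) (cong toℕ eq) (subst (n₁ ≤_) (sym (toℕ-↑ʳ n₁ _)) (m≤m+n n₁ _)))
                                     (<⇒≱ (subst (_< n₁) (sym (toℕ-↑ˡ a _)) (toℕ<n a)))
... | no b≢y | no b≢y' = punchOut-injective b≢y b≢y' (↑ʳ-injective n₁ _ _ eq)

-- `attachAll` in closed form: the base vertices keep their indices, the base
-- edges are padded, and the attached edges follow them.
module _ {B : Set} where

  sizeAfter : ℕ → List (B × Rooted) → ℕ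
  sizeAfter n [] = n
  sizeAfter n ((_ , R) ∷ L) = sizeAfter (n + pred (nv (graph R))) L

  padAfter : ∀ n L → Subset n → Subset (sizeAfter n L)
  padAfter n [] e = e
  padAfter n ((_ , R) ∷ L) e = padAfter (n + pred (nv (graph R))) L (pad (pred (nv (graph R))) e)

  injectAfter : ∀ n L → Fin n → Fin (sizeAfter n L)
  injectAfter n [] y = y
  injectAfter n ((_ , R) ∷ L) y = injectAfter _ L (y ↑ˡ pred (nv (graph R)))

  newEdges : ∀ n (lift : B → Fin n) L → List (Subset (sizeAfter n L))
  newEdges n lift [] = []
  newEdges n lift ((t , R) ∷ L) =
    map (padAfter _ L) (map (image (glueMap (lift t) (root R))) (edges (graph R))) ++
    newEdges _ (λ b → lift b ↑ˡ pred (nv (graph R))) L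

  attachAll-≡ : ∀ n E (lift : B → Fin n) L →
    attachAll (hg n E) lift L ≡ hg (sizeAfter n L) (map (padAfter n L) E ++ newEdges n lift L)
  attachAll-≡ n E lift [] = cong (hg n) (sym (trans (++-identityʳ _) (map-id E)))
  attachAll-≡ n E lift ((t , R) ∷ L) =
    trans (attachAll-≡ _ (map (pad extra) E ++ map (image (glueMap (lift t) (root R))) (edges (graph R))) _ L)
          (cong (hg _) (trans (cong (_++ newEdges _ _ L)
                                    (trans (map-++ (padAfter _ L) (map (pad extra) E) _) (cong (_++ _) (sym (map-∘ E)))))
                              (++-assoc (map (padAfter n ((t , R) ∷ L)) E) _ _)))
    where
    extra : ℕ
    extra = pred (nv (graph R))

  toℕ-injectAfter : ∀ n L y → toℕ (injectAfter n L y) ≡ toℕ y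
  toℕ-injectAfter n [] y = refl
  toℕ-injectAfter n ((_ , R) ∷ L) y = trans (toℕ-injectAfter _ L _) (toℕ-↑ˡ y _)

  ∈-padAfter⁻ : ∀ n L e {x} → x ∈ₛ padAfter n L e → ∃[ y ] y ∈ₛ e × injectAfter n L y ≡ x
  ∈-padAfter⁻ n [] e x∈ = _ , x∈ , refl
  ∈-padAfter⁻ n ((_ , R) ∷ L) e x∈ with ∈-padAfter⁻ _ L _ x∈
  ... | z , z∈ , eq with ∈-pad⁻ e z∈
  ... | y , y∈ , refl = y , y∈ , eq

  ∈-padAfter⁺ : ∀ n L {e y} → y ∈ₛ e → injectAfter n L y ∈ₛ padAfter n L e
  ∈-padAfter⁺ n [] y∈ = y∈
  ∈-padAfter⁺ n ((_ , R) ∷ L) y∈ = ∈-padAfter⁺ _ L (∈-pad⁺ y∈)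

  sizeAfter-≥ : ∀ n L → n ≤ sizeAfter n L
  sizeAfter-≥ n [] = ≤-refl
  sizeAfter-≥ n ((_ , R) ∷ L) = ≤-trans (m≤m+n n _) (sizeAfter-≥ _ L)

  newEdges-cong : ∀ n {lift lift' : B → Fin n} L → (∀ b → lift b ≡ lift' b) →
                  newEdges n lift L ≡ newEdges n lift' L
  newEdges-cong n [] _ = refl
  newEdges-cong n ((t , R) ∷ L) lift≗lift' =
    cong₂ _++_ (cong (λ a → map (padAfter _ L) (map (image (glueMap a (root R))) (edges (graph R)))) (lift≗lift' t))
               (newEdges-cong _ L (λ b → cong (_↑ˡ _) (lift≗lift' b)))

  newEdges-base : ∀ (G : ℕ → Set) n (lift : B → Fin n) L →
    (∀ {b R} → (b , R) ∈ₗ L → G (toℕ (lift b))) →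
    ∀ {g} → g ∈ₗ newEdges n lift L → ∀ {x} → x ∈ₛ g → toℕ x < n → G (toℕ x)
  newEdges-base G n lift ((t , R) ∷ L) G-lift g∈ x∈ x<n
    with ∈-++⁻ (map (padAfter _ L) (map (image (glueMap (lift t) (root R))) (edges (graph R)))) g∈
  ... | inj₂ g∈new = newEdges-base G _ _ L
          (λ bR∈ → subst G (sym (toℕ-↑ˡ _ _)) (G-lift (there bR∈))) g∈new x∈ (≤-trans x<n (m≤m+n n _))
  ... | inj₁ g∈glued with ∈-map⁻ (padAfter _ L) g∈glued
  ... | _ , f'∈ , refl with ∈-map⁻ (image (glueMap (lift t) (root R))) f'∈
  ... | f , _ , refl with ∈-padAfter⁻ _ L _ x∈
  ... | z , z∈ , refl with ∈-image⁻ (glueMap (lift t) (root R)) f z∈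
  ... | w , _ , refl with root R ≟ w
  ...   | yes refl = subst G (sym (trans (toℕ-injectAfter _ L _) (toℕ-glueMap-root (lift t) (root R)))) (G-lift (here refl))
  ...   | no r≢w = contradiction (toℕ-glueMap-other (lift t) (root R) r≢w)
                                 (<⇒≱ (subst (_< n) (toℕ-injectAfter _ L _) x<n))

-- Membership read off through `toℕ`; this compares subsets of differently indexed `Fin` types.
_∋ℕ_ : Subset n₁ → ℕ → Set
e ∋ℕ c = ∃[ y ] y ∈ₛ e × toℕ y ≡ c

∈-padAfter : ∀ {B : Set} n (L : List (B × Rooted)) e x → x ∈ₛ padAfter n L e ⇔ e ∋ℕ toℕ x
∈-padAfter n L e x =
  (λ x∈ → let (y , y∈ , eq) = ∈-padAfter⁻ n L e x∈ in y , y∈ , trans (sym (toℕ-injectAfter n L y)) (cong toℕ eq)) ,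
  (λ { (y , y∈ , eq) → subst (_∈ₛ padAfter n L e) (toℕ-injective (trans (toℕ-injectAfter n L y) eq)) (∈-padAfter⁺ n L y∈) })

pad-∋ℕ : ∀ k (e : Subset n₁) c → pad k e ∋ℕ c ⇔ e ∋ℕ c
pad-∋ℕ k e c =
  (λ { (x , x∈ , refl) → let (y , y∈ , eq) = ∈-pad⁻ e x∈ in y , y∈ , trans (sym (toℕ-↑ˡ y k)) (cong toℕ eq) }) ,
  (λ { (y , y∈ , refl) → y ↑ˡ k , ∈-pad⁺ y∈ , toℕ-↑ˡ y k })

⊤-∋ℕ : ∀ n c → ⊤ {n} ∋ℕ c ⇔ c < n
⊤-∋ℕ n c = (λ { (y , _ , refl) → toℕ<n y }) , (λ c<n → fromℕ< c<n , ∈⊤ , toℕ-fromℕ< c<n)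

-- The base sizes m + r k + s k and m + (r + s) k + 0 met below agree only propositionally.
attachAll-transport : ∀ {B : Set} n n' → n ≡ n' → (lift : B → Fin n) (lift' : B → Fin n') →
  (∀ b → toℕ (lift b) ≡ toℕ (lift' b)) → ∀ L (E' : List (Subset n')) →
  ∃[ pad' ] (∀ e x → x ∈ₛ pad' e ⇔ e ∋ℕ toℕ x) ×
            attachAll (hg n' E') lift' L ≡ hg (sizeAfter n L) (map pad' E' ++ newEdges n lift L)
attachAll-transport n .n refl lift lift' lift≗lift' L E' =
  padAfter n L , ∈-padAfter n L ,
  trans (attachAll-≡ n E' lift' L)
        (cong (λ X → hg _ (map (padAfter n L) E' ++ X)) (newEdges-cong n L (λ b → toℕ-injective (sym (lift≗lift' b)))))

-- The vertex c lies on the t-th edge of a path of edge size k + 1 glued by its vertex 0 onto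
-- the vertex a of a hypergraph on n vertices.
GluedPathEdge : (k n a t c : ℕ) → Set
GluedPathEdge k n a t c = (c ≡ a × t ≡ 0) ⊎ ∃[ z ] c ≡ n + z × t * k ≤ suc z × suc z ≤ t * k + k

∋ℕ-gluedPathEdge : ∀ k .{{_ : NonZero k}} q t → t < q → ∀ {n₁} (a : Fin n₁) c →
  image (glueMap {n₁} {suc (q * k)} a fzero) (pathEdge (suc k) q t) ∋ℕ c ⇔ GluedPathEdge k n₁ (toℕ a) t c
∋ℕ-gluedPathEdge k q t t<q {n₁} a c = to , from
  where
  m : ℕ
  m = suc k
  to : image (glueMap a fzero) (pathEdge m q t) ∋ℕ c → GluedPathEdge k n₁ (toℕ a) t c
  to (y , y∈ , refl) with ∈-image⁻ (glueMap a fzero) (pathEdge m q t) y∈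
  ... | fzero , w∈ , refl = inj₁ (toℕ-↑ˡ a _ , m*n≡0⇒m≡0 t k (n≤0⇒n≡0 (proj₁ (∈-pathEdge⁻ m q t fzero w∈))))
  ... | fsuc z , w∈ , refl = inj₂ (toℕ z , toℕ-↑ʳ n₁ z , ∈-pathEdge⁻ m q t (fsuc z) w∈)
  from : GluedPathEdge k n₁ (toℕ a) t c → image (glueMap a fzero) (pathEdge m q t) ∋ℕ c
  from (inj₁ (refl , refl)) = glueMap a fzero fzero , ∈-image⁺ (glueMap a fzero) _ (∈-pathEdge⁺ m q 0 fzero z≤n z≤n) , toℕ-↑ˡ a _
  from (inj₂ (z , refl , lo , hi)) =
    glueMap a fzero (fsuc z') ,
    ∈-image⁺ (glueMap a fzero) _ (∈-pathEdge⁺ m q t (fsuc z') (subst (λ u → t * k ≤ suc u) (sym z'≡z) lo)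
                                                             (subst (λ u → suc u ≤ t * k + k) (sym z'≡z) hi)) ,
    trans (toℕ-↑ʳ n₁ z') (cong (n₁ +_) z'≡z)
    where
    z<qk : z < q * k
    z<qk = ≤-trans hi (≤-trans (≤-reflexive (+-comm (t * k) k)) (*-monoˡ-≤ k t<q))
    z' : Fin (q * k)
    z' = fromℕ< z<qk
    z'≡z : toℕ z' ≡ z
    z'≡z = toℕ-fromℕ< z<qk

nth : List X → ℕ → Maybe X
nth [] _ = nothing
nth (x ∷ xs) zero = just x
nth (x ∷ xs) (suc i) = nth xs i

nth-map : ∀ (f : X → Y) xs i → nth (map f xs) i ≡ Maybe.map f (nth xs i)
nth-map f [] i = refl
nth-map f (x ∷ xs) zero = refl
nth-map f (x ∷ xs) (suc i) = nth-map f xs i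

nth-lookup : ∀ (xs : List X) j → nth xs (toℕ j) ≡ just (lookup xs j)
nth-lookup (x ∷ xs) fzero = refl
nth-lookup (x ∷ xs) (fsuc j) = nth-lookup xs j

nth-++ˡ : ∀ (xs ys : List X) {i} → i < length xs → nth (xs ++ ys) i ≡ nth xs i
nth-++ˡ (x ∷ xs) ys {zero} _ = refl
nth-++ˡ (x ∷ xs) ys {suc i} i<len = nth-++ˡ xs ys (s≤s⁻¹ i<len)

nth-++ʳ : ∀ (xs ys : List X) i → nth (xs ++ ys) (length xs + i) ≡ nth ys i
nth-++ʳ [] ys i = refl
nth-++ʳ (x ∷ xs) ys i = nth-++ʳ xs ys i

nth-applyUpTo : ∀ (f : ℕ → X) {q i} → i < q → nth (applyUpTo f q) i ≡ just (f i)
nth-applyUpTo f {suc q} {zero} _ = refl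
nth-applyUpTo f {suc q} {suc i} i<q = nth-applyUpTo (f ∘ suc) (s≤s⁻¹ i<q)

nth-< : ∀ (xs : List X) {i} → i < length xs → ∃[ x ] nth xs i ≡ just x
nth-< (x ∷ xs) {zero} _ = x , refl
nth-< (x ∷ xs) {suc i} i<len = nth-< xs (s≤s⁻¹ i<len)

nth⇒∈ : ∀ (xs : List X) i {x} → nth xs i ≡ just x → x ∈ₗ xs
nth⇒∈ (x ∷ xs) zero refl = here refl
nth⇒∈ (x ∷ xs) (suc i) eq = there (nth⇒∈ xs i eq)

∈⇒nth : ∀ {xs : List X} {x} → x ∈ₗ xs → ∃[ i ] i < length xs × nth xs i ≡ just x
∈⇒nth (here refl) = 0 , s≤s z≤n , refl
∈⇒nth (there x∈) with ∈⇒nth x∈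
... | i , i<len , eq = suc i , s≤s i<len , eq

nth-injective : ∀ {xs : List X} → Unique xs → ∀ i i' {x} → nth xs i ≡ just x → nth xs i' ≡ just x → i ≡ i'
nth-injective {xs = _ ∷ _} _ zero zero _ _ = refl
nth-injective {xs = _ ∷ xs} (x∉ ∷ _) zero (suc i') refl eq' = contradiction refl (All.lookup x∉ (nth⇒∈ xs i' eq'))
nth-injective {xs = _ ∷ xs} (x∉ ∷ _) (suc i) zero eq refl = contradiction refl (All.lookup x∉ (nth⇒∈ xs i eq))
nth-injective {xs = _ ∷ _} (_ ∷ xs!) (suc i) (suc i') eq eq' = cong suc (nth-injective xs! i i' eq eq')

members : Subset n₁ → List (Fin n₁)
members [] = []
members (true ∷ s) = fzero ∷ map fsuc (members s)
members (false ∷ s) = map fsuc (members s)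

length-members : (s : Subset n₁) → length (members s) ≡ ∣ s ∣
length-members [] = refl
length-members (true ∷ s) = cong suc (trans (length-map fsuc (members s)) (length-members s))
length-members (false ∷ s) = trans (length-map fsuc (members s)) (length-members s)

∈-members⁻ : (s : Subset n₁) {x : Fin n₁} → x ∈ₗ members s → x ∈ₛ s
∈-members⁻ (true ∷ s) (here refl) = here
∈-members⁻ (true ∷ s) (there x∈) with ∈-map⁻ fsuc x∈
... | y , y∈ , refl = there (∈-members⁻ s y∈)
∈-members⁻ (false ∷ s) x∈ with ∈-map⁻ fsuc x∈
... | y , y∈ , refl = there (∈-members⁻ s y∈)

∈-members⁺ : (s : Subset n₁) {x : Fin n₁} → x ∈ₛ s → x ∈ₗ members s
∈-members⁺ (true ∷ s) here = here refl
∈-members⁺ (true ∷ s) (there x∈) = there (∈-map⁺ fsuc (∈-members⁺ s x∈))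
∈-members⁺ (false ∷ s) (there x∈) = ∈-map⁺ fsuc (∈-members⁺ s x∈)

members-unique : (s : Subset n₁) → Unique (members s)
members-unique [] = []
members-unique (true ∷ s) =
  All.tabulate (λ x∈ 0≡x → let (_ , _ , x≡suc) = ∈-map⁻ fsuc x∈ in 0≢suc (trans 0≡x x≡suc))
  ∷ Uniqueₚ.map⁺ Finₚ.suc-injective (members-unique s)
  where
  0≢suc : ∀ {y : Fin n₁} → fzero ≢ fsuc y
  0≢suc ()
members-unique (false ∷ s) = Uniqueₚ.map⁺ Finₚ.suc-injective (members-unique s)

swap₀ : ℕ → ℕ → ℕ
swap₀ i₀ zero = i₀
swap₀ i₀ (suc i) with suc i ℕ.≟ i₀
... | yes _ = zero
... | no _ = suc i

swap₀-involutive : ∀ i₀ i → swap₀ i₀ (swap₀ i₀ i) ≡ i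
swap₀-involutive zero zero = refl
swap₀-involutive (suc j) zero with suc j ℕ.≟ suc j
... | yes _ = refl
... | no j≢j = contradiction refl j≢j
swap₀-involutive i₀ (suc i) with suc i ℕ.≟ i₀
... | yes refl = refl
... | no i≢i₀ with suc i ℕ.≟ i₀
...   | yes i≡i₀ = contradiction i≡i₀ i≢i₀
...   | no _ = refl

swap₀-< : ∀ {i₀ i L} → i₀ < L → i < L → swap₀ i₀ i < L
swap₀-< {i = zero} i₀<L _ = i₀<L
swap₀-< {i₀} {suc i} i₀<L i<L with suc i ℕ.≟ i₀
... | yes _ = <-≤-trans (s≤s z≤n) i<L
... | no _ = i<L

record Enumeration (s : Subset n₁) (k : ℕ) (x₀ : Fin n₁) : Set where
  field
    at : ℕ → Fin n₁
    at-0 : at 0 ≡ x₀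
    at-∈ : ∀ {i} → i ≤ k → at i ∈ₛ s
    at-onto : ∀ {x} → x ∈ₛ s → ∃[ i ] i ≤ k × at i ≡ x
    at-injective : ∀ {i i'} → i ≤ k → i' ≤ k → at i ≡ at i' → i ≡ i'

enumeration : ∀ {n} (s : Subset n) {k : ℕ} → ∣ s ∣ ≡ suc k → {x₀ : Fin n} → x₀ ∈ₛ s → Enumeration s k x₀
enumeration {n} s {k} ∣s∣≡1+k {x₀} x₀∈ = record
  { at = at
  ; at-0 = cong (fromMaybe x₀) nth-i₀
  ; at-∈ = λ i≤k → ∈-members⁻ s (nth⇒∈ xs _ (nth-at i≤k))
  ; at-onto = at-onto
  ; at-injective = λ i≤k i'≤k at≡ → trans (sym (swap₀-involutive i₀ _))
      (trans (cong (swap₀ i₀) (nth-injective (members-unique s) _ _ (nth-at i≤k) (trans (nth-at i'≤k) (cong just (sym at≡)))))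
             (swap₀-involutive i₀ _))
  }
  where
  xs : List (Fin n)
  xs = members s
  length-xs : length xs ≡ suc k
  length-xs = trans (length-members s) ∣s∣≡1+k
  i₀ : ℕ
  i₀ = proj₁ (∈⇒nth (∈-members⁺ s x₀∈))
  i₀<len : i₀ < length xs
  i₀<len = proj₁ (proj₂ (∈⇒nth (∈-members⁺ s x₀∈)))
  nth-i₀ : nth xs i₀ ≡ just x₀
  nth-i₀ = proj₂ (proj₂ (∈⇒nth (∈-members⁺ s x₀∈)))
  at : ℕ → Fin n
  at i = fromMaybe x₀ (nth xs (swap₀ i₀ i))
  nth-at : ∀ {i} → i ≤ k → nth xs (swap₀ i₀ i) ≡ just (at i)
  nth-at {i} i≤k with nth-< xs (swap₀-< i₀<len (subst (i <_) (sym length-xs) (s≤s i≤k)))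
  ... | x , eq rewrite eq = refl
  at-onto : ∀ {x} → x ∈ₛ s → ∃[ i ] i ≤ k × at i ≡ x
  at-onto x∈ with ∈⇒nth (∈-members⁺ s x∈)
  ... | j , j<len , eq =
    swap₀ i₀ j , s≤s⁻¹ (subst (swap₀ i₀ j <_) length-xs (swap₀-< i₀<len j<len)) ,
    cong (fromMaybe x₀) (trans (cong (nth xs) (swap₀-involutive i₀ j)) eq)

-- Coordinates and the folding map

MapsOnto : (ℕ → ℕ) → (ℕ → Set) → (ℕ → Set) → Set
MapsOnto f P Q = (∀ c → P c → Q (f c)) × (∀ d → Q d → ∃[ c ] P c × f c ≡ d)

-- Vertex numbering shared by H^e_{r,s} and H^e_{r+s,0} (with r = r0 + 1, s = s0 + 1, k = m - 1):
-- the edge e is 0 … k with u = 0, v = 1 and w_i = i + 1; the path at u has vertex vtx w at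
-- position w, and the path at v (in H^e_{r,s}) has vertex vtx (r k + w) at position w > 0.
-- OnPath t and OnBranch t are the vertex sets of the t-th edges (from 0) of these two paths.
module Coordinates (a r0 s0 : ℕ) where
  k m r s R1 Rk n : ℕ
  k = suc (suc a)
  m = suc k
  r = suc r0
  s = suc s0
  R1 = r0 * k
  Rk = r * k
  n = m + (r + s) * k

  vtx : ℕ → ℕ
  vtx zero = zero
  vtx (suc z) = m + z

  OnPath : ℕ → ℕ → Set
  OnPath t c = ∃[ w ] c ≡ vtx w × t * k ≤ w × w ≤ t * k + k

  OnBranch : ℕ → ℕ → Set
  OnBranch t c = (c ≡ 1 × t ≡ 0) ⊎ ∃[ w ] c ≡ vtx (Rk + w) × 0 < w × t * k ≤ w × w ≤ t * k + k

  -- The folding map: the path at u is bent at position r0 k so that the path edge r0 lands on e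
  -- (with the far end r k on v) and the path edges before it are reflected onto the start of the path.
  foldCoord : ℕ → ℕ
  foldCoord w with w ≤? R1
  ... | yes _ = vtx (R1 ∸ w)
  ... | no _ with suc w ≤? Rk
  ... | yes _ = suc (w ∸ R1)
  ... | no _ with w ℕ.≟ Rk
  ... | yes _ = 1
  ... | no _ = vtx w

  foldCoord-≤R1 : ∀ w → w ≤ R1 → foldCoord w ≡ vtx (R1 ∸ w)
  foldCoord-≤R1 w h with w ≤? R1
  ... | yes _ = refl
  ... | no ¬h = ⊥-elim (¬h h)

  foldCoord-mid : ∀ w → R1 < w → w < Rk → foldCoord w ≡ suc (w ∸ R1)
  foldCoord-mid w h1 h2 with w ≤? R1
  ... | yes p = ⊥-elim (<⇒≱ h1 p)
  ... | no _ with suc w ≤? Rk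
  ... | yes _ = refl
  ... | no ¬h = ⊥-elim (¬h h2)

  foldCoord-Rk : foldCoord Rk ≡ 1
  foldCoord-Rk with Rk ≤? R1
  ... | yes p = ⊥-elim (<⇒≱ (m<n+m R1 {k} (s≤s z≤n)) p)
  ... | no _ with suc Rk ≤? Rk
  ... | yes p = ⊥-elim (<-irrefl refl p)
  ... | no _ with Rk ℕ.≟ Rk
  ... | yes _ = refl
  ... | no ¬p = ⊥-elim (¬p refl)

  foldCoord->Rk : ∀ w → Rk < w → foldCoord w ≡ vtx w
  foldCoord->Rk w h with w ≤? R1
  ... | yes p = ⊥-elim (<⇒≱ (<-trans (m<n+m R1 {k} (s≤s z≤n)) h) p)
  ... | no _ with suc w ≤? Rk
  ... | yes p = ⊥-elim (<-asym h p)
  ... | no _ with w ℕ.≟ Rk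
  ... | yes p = ⊥-elim (<⇒≢ h (sym p))
  ... | no _ = refl

  fold : ℕ → ℕ
  fold zero = foldCoord 0
  fold (suc c) with suc c <? m
  ... | yes _ = vtx (suc c)
  ... | no _ = foldCoord (suc (c ∸ k))

  fold-vtx : ∀ w → fold (vtx w) ≡ foldCoord w
  fold-vtx zero = refl
  fold-vtx (suc z) with m + z <? m
  ... | yes p = ⊥-elim (<⇒≱ p (m≤m+n m z))
  ... | no _ = cong (λ q → foldCoord (suc q)) (m+n∸m≡n k z)

  fold-e : ∀ c → 0 < c → c < m → fold c ≡ vtx c
  fold-e (suc c) _ h with suc c <? m
  ... | yes _ = refl
  ... | no ¬h = ⊥-elim (¬h h)

  vtx-injective : ∀ w w' → vtx w ≡ vtx w' → w ≡ w'
  vtx-injective zero zero _ = refl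
  vtx-injective zero (suc w') ()
  vtx-injective (suc w) zero ()
  vtx-injective (suc w) (suc w') e = cong suc (+-cancelˡ-≡ m w w' e)

  vtx<m : ∀ w → vtx w < m → w ≡ 0
  vtx<m zero _ = refl
  vtx<m (suc z) h = ⊥-elim (<⇒≱ h (m≤m+n m z))

  vtx-< : ∀ w W → w ≤ W → vtx w < m + W
  vtx-< zero W _ = s≤s z≤n
  vtx-< (suc z) W h = +-monoʳ-< m h

  coord-cases : ∀ w → w ≤ R1 ⊎ (R1 < w × w < Rk) ⊎ w ≡ Rk ⊎ Rk < w
  coord-cases w with w ≤? R1
  ... | yes p = inj₁ p
  ... | no p with suc w ≤? Rk
  ... | yes q = inj₂ (inj₁ (≰⇒> p , q))
  ... | no q with w ℕ.≟ Rk
  ... | yes e = inj₂ (inj₂ (inj₁ e))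
  ... | no e = inj₂ (inj₂ (inj₂ (≤∧≢⇒< (≮⇒≥ q) (λ z → e (sym z)))))

  k≤Rk : k ≤ Rk
  k≤Rk = m≤m+n k R1

  OnPath-<n : ∀ t c → t < r + s → OnPath t c → c < n
  OnPath-<n t c t< (w , refl , _ , h) = vtx-< w _ (≤-trans h (≤-trans (≤-reflexive (+-comm (t * k) k)) (*-monoˡ-≤ k t<)))

  fold-e↠path₀ : r0 ≡ 0 → MapsOnto fold (_< m) (OnPath 0)
  fold-e↠path₀ r0≡0 = to , from
    where
    R1≡0 : R1 ≡ 0
    R1≡0 = cong (_* k) r0≡0
    fold-0 : fold 0 ≡ 0
    fold-0 = trans (foldCoord-≤R1 0 (≤-reflexive (sym R1≡0))) (cong vtx R1≡0)
    to : ∀ c → c < m → OnPath 0 (fold c)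
    to zero _ = 0 , fold-0 , z≤n , z≤n
    to (suc c) h = suc c , fold-e (suc c) (s≤s z≤n) h , z≤n , s≤s⁻¹ h
    from : ∀ d → OnPath 0 d → ∃[ c ] c < m × fold c ≡ d
    from d (zero , refl , _ , _) = 0 , s≤s z≤n , fold-0
    from d (suc z , refl , _ , h) = suc z , s≤s h , fold-e (suc z) (s≤s z≤n) (s≤s h)

  fold-path↠path₀ : ∀ t → t * k + k ≡ R1 → MapsOnto fold (OnPath t) (OnPath 0)
  fold-path↠path₀ t tk+k≡R1 = to , from
    where
    to : ∀ c → OnPath t c → OnPath 0 (fold c)
    to c (w , refl , h1 , h2) = R1 ∸ w , trans (fold-vtx w) (foldCoord-≤R1 w (subst (w ≤_) tk+k≡R1 h2)) , z≤n ,
      ≤-trans (∸-monoʳ-≤ R1 h1) (≤-reflexive (trans (cong (_∸ t * k) (sym tk+k≡R1)) (m+n∸m≡n (t * k) k)))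
    from : ∀ d → OnPath 0 d → ∃[ c ] OnPath t c × fold c ≡ d
    from d (w , refl , _ , h) = vtx (R1 ∸ w) , (R1 ∸ w , refl ,
        ≤-trans (≤-reflexive (sym (trans (cong (_∸ k) (sym tk+k≡R1)) (m+n∸n≡m (t * k) k)))) (∸-monoʳ-≤ R1 h) ,
        ≤-trans (m∸n≤m R1 w) (≤-reflexive (sym tk+k≡R1))) ,
      trans (fold-vtx (R1 ∸ w)) (trans (foldCoord-≤R1 (R1 ∸ w) (m∸n≤m R1 w)) (cong vtx (m∸[m∸n]≡n w≤R1)))
      where
      w≤R1 : w ≤ R1
      w≤R1 = ≤-trans h (subst (k ≤_) tk+k≡R1 (m≤n+m k (t * k)))

  fold-path↠e : MapsOnto fold (OnPath r0) (_< m)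
  fold-path↠e = to , from
    where
    to : ∀ c → OnPath r0 c → fold c < m
    to c (w , refl , h1 , h2) rewrite fold-vtx w with coord-cases w
    ... | inj₁ p rewrite foldCoord-≤R1 w p | m≤n⇒m∸n≡0 h1 = s≤s z≤n
    ... | inj₂ (inj₁ (p , q)) rewrite foldCoord-mid w p q =
      s≤s (subst (_≤ k) (+-∸-assoc 1 (<⇒≤ p)) (≤-trans (∸-monoˡ-≤ R1 q) (≤-reflexive (m+n∸n≡m k R1))))
    ... | inj₂ (inj₂ (inj₁ refl)) rewrite foldCoord-Rk = s≤s (s≤s z≤n)
    ... | inj₂ (inj₂ (inj₂ p)) = ⊥-elim (<⇒≱ p (subst (w ≤_) (+-comm R1 k) h2))
    from : ∀ d → d < m → ∃[ c ] OnPath r0 c × fold c ≡ d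
    from zero _ = vtx R1 , (R1 , refl , ≤-refl , m≤m+n R1 k) ,
      trans (fold-vtx R1) (trans (foldCoord-≤R1 R1 ≤-refl) (cong vtx (n∸n≡0 R1)))
    from (suc zero) _ = vtx Rk , (Rk , refl , m≤n+m R1 k , ≤-reflexive (+-comm k R1)) , trans (fold-vtx Rk) foldCoord-Rk
    from (suc (suc d)) h = vtx (R1 + suc d) , (R1 + suc d , refl , m≤m+n R1 _ , +-monoʳ-≤ R1 (<⇒≤ (s≤s⁻¹ h))) ,
      trans (fold-vtx (R1 + suc d)) (trans (foldCoord-mid (R1 + suc d) (m<m+n R1 (s≤s z≤n))
         (subst (suc (R1 + suc d) ≤_) (+-comm R1 k) (subst (_≤ R1 + k) (+-suc R1 (suc d)) (+-monoʳ-≤ R1 (s≤s⁻¹ h)))))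
         (cong suc (m+n∸m≡n R1 (suc d))))

  fold-path↠branch₀ : MapsOnto fold (OnPath r) (OnBranch 0)
  fold-path↠branch₀ = to , from
    where
    to : ∀ c → OnPath r c → OnBranch 0 (fold c)
    to c (w , refl , h1 , h2) rewrite fold-vtx w with m≤n⇒m<n∨m≡n h1
    ... | inj₂ refl = inj₁ (foldCoord-Rk , refl)
    ... | inj₁ p = inj₂ (w ∸ Rk , trans (foldCoord->Rk w p) (cong vtx (sym (m+[n∸m]≡n h1))) ,
           subst (_< w ∸ Rk) (n∸n≡0 Rk) (∸-monoˡ-< p ≤-refl) , z≤n ,
           ≤-trans (∸-monoˡ-≤ Rk h2) (≤-reflexive (m+n∸m≡n Rk k)))
    from : ∀ d → OnBranch 0 d → ∃[ c ] OnPath r c × fold c ≡ d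
    from d (inj₁ (refl , _)) = vtx Rk , (Rk , refl , ≤-refl , m≤m+n Rk k) , trans (fold-vtx Rk) foldCoord-Rk
    from d (inj₂ (w , refl , w>0 , _ , h)) = vtx (Rk + w) , (Rk + w , refl , m≤m+n Rk w , +-monoʳ-≤ Rk h) ,
      trans (fold-vtx (Rk + w)) (foldCoord->Rk (Rk + w) (m<m+n Rk w>0))

  -- The path edge r + t of H^e_{r+s,0} is the path edge t at v of H^e_{r,s}, vertex for vertex.
  module _ (t : ℕ) (1≤t : 1 ≤ t) where
    private
      Rk+tk≡ : (r + t) * k ≡ Rk + t * k
      Rk+tk≡ = *-distribʳ-+ k r t
      Rk<w : ∀ {w} → (r + t) * k ≤ w → Rk < w
      Rk<w {w} h = <-≤-trans (m<m+n Rk (≤-trans (s≤s z≤n) (*-monoˡ-≤ k 1≤t))) (subst (_≤ w) Rk+tk≡ h)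

    OnPath⇒OnBranch : ∀ c → OnPath (r + t) c → OnBranch t c
    OnPath⇒OnBranch c (w , refl , h1 , h2) = inj₂ (w ∸ Rk , cong vtx (sym (m+[n∸m]≡n (<⇒≤ (Rk<w h1)))) ,
        subst (_< w ∸ Rk) (n∸n≡0 Rk) (∸-monoˡ-< (Rk<w h1) ≤-refl) ,
        subst (_≤ w ∸ Rk) (m+n∸m≡n Rk (t * k)) (∸-monoˡ-≤ Rk (subst (_≤ w) Rk+tk≡ h1)) ,
        subst (w ∸ Rk ≤_) (trans (cong (_∸ Rk) (+-assoc Rk (t * k) k)) (m+n∸m≡n Rk (t * k + k)))
           (∸-monoˡ-≤ Rk (subst (λ z → w ≤ z + k) Rk+tk≡ h2)))

    OnBranch⇒OnPath : ∀ c → OnBranch t c → OnPath (r + t) c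
    OnBranch⇒OnPath c (inj₁ (_ , refl)) = ⊥-elim (<⇒≱ 1≤t z≤n)
    OnBranch⇒OnPath c (inj₂ (w , refl , _ , h1 , h2)) = Rk + w , refl ,
      subst (_≤ Rk + w) (sym Rk+tk≡) (+-monoʳ-≤ Rk h1) ,
      subst (Rk + w ≤_) (trans (sym (+-assoc Rk (t * k) k)) (cong (_+ k) (sym Rk+tk≡))) (+-monoʳ-≤ Rk h2)

    fold-path : ∀ c → OnPath (r + t) c → fold c ≡ c
    fold-path c (w , refl , h1 , _) = trans (fold-vtx w) (foldCoord->Rk w (Rk<w h1))

    fold-path↠branch : MapsOnto fold (OnPath (r + t)) (OnBranch t)
    fold-path↠branch =
      (λ c c∈ → subst (OnBranch t) (sym (fold-path c c∈)) (OnPath⇒OnBranch c c∈)) ,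
      (λ d d∈ → d , OnBranch⇒OnPath d d∈ , fold-path d (OnBranch⇒OnPath d d∈))

  -- A left inverse of fold on FoldDomain.
  unfoldPath : ℕ → ℕ
  unfoldPath z with suc z ≤? k
  ... | no _ = vtx (suc z)
  ... | yes _ with r0 ℕ.≟ 0
  ... | yes _ = suc z
  ... | no _ = vtx (R1 ∸ suc z)

  unfold : ℕ → ℕ
  unfold zero = vtx R1
  unfold (suc zero) = vtx Rk
  unfold (suc (suc d)) with suc (suc d) <? m
  ... | yes _ = vtx (R1 + suc d)
  ... | no _ = unfoldPath (d ∸ suc a)

  unfold-path : ∀ z → unfold (m + z) ≡ unfoldPath z
  unfold-path z with m + z <? m
  ... | yes p = ⊥-elim (<⇒≱ p (m≤m+n m z))
  ... | no _ = cong unfoldPath (m+n∸m≡n (suc a) z)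

  unfold-e : ∀ d → suc (suc d) < m → unfold (suc (suc d)) ≡ vtx (R1 + suc d)
  unfold-e d h with suc (suc d) <? m
  ... | yes _ = refl
  ... | no ¬h = ⊥-elim (¬h h)

  unfoldPath-r0≡0 : ∀ z → suc z ≤ k → r0 ≡ 0 → unfoldPath z ≡ suc z
  unfoldPath-r0≡0 z h e with suc z ≤? k
  ... | no ¬h = ⊥-elim (¬h h)
  ... | yes _ with r0 ℕ.≟ 0
  ... | yes _ = refl
  ... | no ¬e = ⊥-elim (¬e e)

  unfoldPath-r0≢0 : ∀ z → suc z ≤ k → r0 ≢ 0 → unfoldPath z ≡ vtx (R1 ∸ suc z)
  unfoldPath-r0≢0 z h e with suc z ≤? k
  ... | no ¬h = ⊥-elim (¬h h)
  ... | yes _ with r0 ℕ.≟ 0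
  ... | yes e' = ⊥-elim (e e')
  ... | no _ = refl

  unfoldPath->k : ∀ z → k < suc z → unfoldPath z ≡ vtx (suc z)
  unfoldPath->k z h with suc z ≤? k
  ... | no _ = refl
  ... | yes p = ⊥-elim (<⇒≱ h p)

  FoldDomain : ℕ → Set
  FoldDomain c = (r0 ≡ 0 × c < m) ⊎ ∃[ w ] c ≡ vtx w × (r0 ∸ 1) * k ≤ w

  unfold-fold : ∀ c → FoldDomain c → unfold (fold c) ≡ c
  unfold-fold c (inj₁ (r0≡0 , c<m)) = on-e c c<m
    where
    R1≡0 : R1 ≡ 0
    R1≡0 = cong (_* k) r0≡0
    on-e : ∀ c → c < m → unfold (fold c) ≡ c
    on-e zero _ = trans (cong unfold (trans (foldCoord-≤R1 0 (≤-reflexive (sym R1≡0))) (cong vtx R1≡0))) (cong vtx R1≡0)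
    on-e (suc c) h = trans (cong unfold (fold-e (suc c) (s≤s z≤n) h)) (trans (unfold-path c) (unfoldPath-r0≡0 c (s≤s⁻¹ h) r0≡0))
  unfold-fold c (inj₂ (w , refl , lw)) rewrite fold-vtx w with coord-cases w
  ... | inj₁ p rewrite foldCoord-≤R1 w p = reflected (R1 ∸ w) refl
    where
    reflected : ∀ q → R1 ∸ w ≡ q → unfold (vtx q) ≡ vtx w
    reflected zero e = cong vtx (≤-antisym (m∸n≡0⇒m≤n e) p)
    reflected (suc z) e = trans (unfold-path z) (trans (unfoldPath-r0≢0 z z<k r0≢0) (cong vtx (trans (cong (R1 ∸_) (sym e)) (m∸[m∸n]≡n p))))
      where
      r0≢0 : r0 ≢ 0
      r0≢0 r0≡0 = 1+n≢0 (trans (sym e) (trans (cong (λ r0 → r0 * k ∸ w) r0≡0) (0∸n≡0 w)))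
      bound : ∀ {r'} → suc r' ≡ r0 → suc z ≤ k
      bound {r'} refl = subst (_≤ k) e (≤-trans (∸-monoʳ-≤ R1 lw) (≤-reflexive (m+n∸n≡m k (r' * k))))
      z<k : suc z ≤ k
      z<k = bound (suc-pred r0 {{≢-nonZero r0≢0}})
  ... | inj₂ (inj₁ (p , q)) rewrite foldCoord-mid w p q = bent (w ∸ R1) refl
    where
    bent : ∀ q' → w ∸ R1 ≡ q' → unfold (suc q') ≡ vtx w
    bent zero e = ⊥-elim (<⇒≱ p (m∸n≡0⇒m≤n e))
    bent (suc d) e = trans (unfold-e d lt) (cong vtx (trans (cong (R1 +_) (sym e)) (m+[n∸m]≡n (<⇒≤ p))))
      where
      lt : suc (suc d) < m
      lt = s≤s (subst (_≤ k) (trans (+-∸-assoc 1 (<⇒≤ p)) (cong suc e)) (≤-trans (∸-monoˡ-≤ R1 q) (≤-reflexive (m+n∸n≡m k R1))))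
  ... | inj₂ (inj₂ (inj₁ refl)) rewrite foldCoord-Rk = refl
  ... | inj₂ (inj₂ (inj₂ p)) rewrite foldCoord->Rk w p = straight w refl p
    where
    straight : ∀ w' → w ≡ w' → Rk < w' → unfold (vtx w') ≡ vtx w'
    straight (suc z) _ h = trans (unfold-path z) (unfoldPath->k z (≤-<-trans k≤Rk h))

  fold-injective : ∀ c c' → FoldDomain c → FoldDomain c' → fold c ≡ fold c' → c ≡ c'
  fold-injective c c' h h' e = trans (sym (unfold-fold c h)) (trans (cong unfold e) (unfold-fold c' h'))

  OnPath-meet : ∀ t t' c → OnPath t c → OnPath t' c → t ≤ suc t'
  OnPath-meet t t' c (w , refl , h1 , h2) (w' , e , h1' , h2') with vtx-injective w w' e
  ... | refl = *-cancelʳ-≤ t (suc t') k (≤-trans h1 (≤-trans h2' (≤-reflexive (+-comm (t' * k) k))))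

  OnPath-<m : ∀ t c → OnPath t c → c < m → c ≡ 0 × t ≡ 0
  OnPath-<m t c (w , refl , h1 , h2) lt with vtx<m w lt
  ... | refl = refl , tz t h1
    where
    tz : ∀ t → t * k ≤ 0 → t ≡ 0
    tz zero _ = refl
    tz (suc t) ()

  OnPath-FoldDomain : ∀ t c → r0 ∸ 1 ≤ t → OnPath t c → FoldDomain c
  OnPath-FoldDomain t c lt (w , e , h1 , h2) = inj₂ (w , e , ≤-trans (*-monoˡ-≤ k lt) h1)

  R1<n : vtx R1 < n
  R1<n = vtx-< R1 ((r + s) * k) (*-monoˡ-≤ k (≤-trans (n≤1+n r0) (m≤m+n r s)))

  k≤rsk : k ≤ (r + s) * k
  k≤rsk = ≤-trans (m≤m+n k _) (*-monoˡ-≤ k (m≤m+n r s))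

  m<n : m < n
  m<n = m<m+n m (≤-trans (s≤s z≤n) k≤rsk)

  foldCoord-< : ∀ w → foldCoord w < n ⊎ foldCoord w ≡ vtx w
  foldCoord-< w with coord-cases w
  ... | inj₁ p rewrite foldCoord-≤R1 w p = inj₁ (≤-<-trans (ix-mono (R1 ∸ w) R1 (m∸n≤m R1 w)) R1<n)
    where
    ix-mono : ∀ u v → u ≤ v → vtx u ≤ vtx v
    ix-mono zero v _ = z≤n
    ix-mono (suc u) (suc v) h = +-monoʳ-≤ m (s≤s⁻¹ h)
  ... | inj₂ (inj₁ (p , q)) rewrite foldCoord-mid w p q = inj₁ (<-trans (s≤s (subst (_≤ k) (+-∸-assoc 1 (<⇒≤ p)) (≤-trans (∸-monoˡ-≤ R1 q) (≤-reflexive (m+n∸n≡m k R1))))) m<n)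
  ... | inj₂ (inj₂ (inj₁ refl)) rewrite foldCoord-Rk = inj₁ (<-trans (s≤s (s≤s z≤n)) m<n)
  ... | inj₂ (inj₂ (inj₂ p)) = inj₂ (foldCoord->Rk w p)

  fold-< : ∀ N → n ≤ N → ∀ c → c < N → fold c < N
  fold-< N nN zero _ with foldCoord-< 0
  ... | inj₁ p = ≤-trans p nN
  ... | inj₂ e rewrite e = ≤-trans (s≤s z≤n) (≤-trans (<⇒≤ m<n) nN)
  fold-< N nN (suc c) h with suc c <? m
  ... | yes p = ≤-trans (vtx-< (suc c) ((r + s) * k) (≤-trans (s≤s⁻¹ p) k≤rsk)) nN
  ... | no p with foldCoord-< (suc (c ∸ k))
  ... | inj₁ q = ≤-trans q nN
  ... | inj₂ e rewrite e = subst (λ q → suc q ≤ N) (sym (cong suc (m+[n∸m]≡n (s≤s⁻¹ (≮⇒≥ p))))) h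

  relabel : ℕ → ℕ
  relabel t with t ℕ.≟ r
  ... | yes _ = 0
  ... | no _ with t ℕ.≟ r0
  ... | yes _ = 1
  ... | no _ = t

  relabel-r : relabel r ≡ 0
  relabel-r with r ℕ.≟ r
  ... | yes _ = refl
  ... | no ¬p = ⊥-elim (¬p refl)

  relabel-r0 : relabel r0 ≡ 1
  relabel-r0 with r0 ℕ.≟ r
  ... | yes p = ⊥-elim (<⇒≢ (n<1+n r0) p)
  ... | no _ with r0 ℕ.≟ r0
  ... | yes _ = refl
  ... | no ¬p = ⊥-elim (¬p refl)

  relabel->r : ∀ t → r < t → relabel t ≡ t
  relabel->r t h with t ℕ.≟ r
  ... | yes p = ⊥-elim (<⇒≢ h (sym p))
  ... | no _ with t ℕ.≟ r0
  ... | yes p = ⊥-elim (<⇒≢ (<-trans (n<1+n r0) h) (sym p))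
  ... | no _ = refl

  NearEps : ℕ → Set
  NearEps t = r0 ≤ t × t ≤ r + 3 × t ≤ r + s

  NearEps-cases : ∀ t → NearEps t → t ≡ r0 ⊎ t ≡ r ⊎ r < t
  NearEps-cases t (h1 , _ , _) with m≤n⇒m<n∨m≡n h1
  ... | inj₂ e = inj₁ (sym e)
  ... | inj₁ p with m≤n⇒m<n∨m≡n p
  ... | inj₂ e = inj₂ (inj₁ (sym e))
  ... | inj₁ q = inj₂ (inj₂ q)

  relabel-injective : ∀ t t' → NearEps t → NearEps t' → relabel t ≡ relabel t' → t ≡ t'
  relabel-injective t t' h h' e with NearEps-cases t h | NearEps-cases t' h'
  ... | inj₁ refl | inj₁ refl = refl
  ... | inj₁ refl | inj₂ (inj₁ refl) = ⊥-elim (1+n≢0 (trans (sym relabel-r0) (trans e relabel-r)))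
  ... | inj₁ refl | inj₂ (inj₂ q) = ⊥-elim (<⇒≢ (≤-<-trans (s≤s z≤n) q) (trans (sym relabel-r0) (trans e (relabel->r t' q))))
  ... | inj₂ (inj₁ refl) | inj₁ refl = ⊥-elim (1+n≢0 (trans (sym relabel-r0) (trans (sym e) relabel-r)))
  ... | inj₂ (inj₁ refl) | inj₂ (inj₁ refl) = refl
  ... | inj₂ (inj₁ refl) | inj₂ (inj₂ q) = ⊥-elim (<⇒≢ (≤-<-trans z≤n q) (trans (sym relabel-r) (trans e (relabel->r t' q))))
  ... | inj₂ (inj₂ q) | inj₁ refl = ⊥-elim (<⇒≢ (≤-<-trans (s≤s z≤n) q) (trans (sym relabel-r0) (trans (sym e) (relabel->r t q))))
  ... | inj₂ (inj₂ q) | inj₂ (inj₁ refl) = ⊥-elim (<⇒≢ (≤-<-trans z≤n q) (trans (sym relabel-r) (trans (sym e) (relabel->r t q))))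
  ... | inj₂ (inj₂ q) | inj₂ (inj₂ q') = trans (sym (relabel->r t q)) (trans e (relabel->r t' q'))

  relabel-≤ : ∀ t → NearEps t → relabel t ≤ r + s
  relabel-≤ t h with NearEps-cases t h
  ... | inj₁ refl rewrite relabel-r0 = s≤s z≤n
  ... | inj₂ (inj₁ refl) rewrite relabel-r = z≤n
  ... | inj₂ (inj₂ q) rewrite relabel->r t q = proj₂ (proj₂ h)

  relabel-< : ∀ t M → 2 ≤ M → t < M → relabel t < M
  relabel-< t M hM ht with t ℕ.≟ r
  ... | yes _ = ≤-trans (s≤s z≤n) hM
  ... | no _ with t ℕ.≟ r0
  ... | yes _ = hM
  ... | no _ = ht

  -- The vertices 0 … 2k - 1 of the extra copy of P₃ (see ξ below), avoiding w₁ = 2.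
  extra : ℕ → ℕ
  extra y with suc y ≤? k
  ... | yes _ = vtx (Rk + (k ∸ y))
  ... | no _ with y ℕ.≟ k
  ... | yes _ = 1
  ... | no _ with y ℕ.≟ suc k
  ... | yes _ = 0
  ... | no _ = suc (y ∸ k)

  extra-<k : ∀ y → y < k → extra y ≡ vtx (Rk + (k ∸ y))
  extra-<k y h with suc y ≤? k
  ... | yes _ = refl
  ... | no ¬h = ⊥-elim (¬h h)

  extra-k : extra k ≡ 1
  extra-k with suc k ≤? k
  ... | yes p = ⊥-elim (<-irrefl refl p)
  ... | no _ with k ℕ.≟ k
  ... | yes _ = refl
  ... | no ¬p = ⊥-elim (¬p refl)

  extra-1+k : extra (suc k) ≡ 0
  extra-1+k with suc (suc k) ≤? k
  ... | yes p = ⊥-elim (<-asym (n<1+n k) (≤-trans (n<1+n (suc k)) p))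
  ... | no _ with suc k ℕ.≟ k
  ... | yes p = ⊥-elim (<⇒≢ (n<1+n k) (sym p))
  ... | no _ with suc k ℕ.≟ suc k
  ... | yes _ = refl
  ... | no ¬p = ⊥-elim (¬p refl)

  extra-≥2+k : ∀ y → suc (suc k) ≤ y → extra y ≡ suc (y ∸ k)
  extra-≥2+k y h with suc y ≤? k
  ... | yes p = ⊥-elim (<-asym (<-trans (n<1+n k) h) p)
  ... | no _ with y ℕ.≟ k
  ... | yes refl = ⊥-elim (<⇒≱ h (n≤1+n k))
  ... | no _ with y ℕ.≟ suc k
  ... | yes refl = ⊥-elim (<-irrefl refl h)
  ... | no _ = refl

  vtx-Rk+ : ∀ z → vtx (Rk + suc z) ≡ m + (Rk + z)
  vtx-Rk+ z = cong vtx (+-suc Rk z)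

  extra⁻¹ : ℕ → ℕ
  extra⁻¹ d with d <? m
  extra⁻¹ zero | yes _ = suc k
  extra⁻¹ (suc zero) | yes _ = k
  extra⁻¹ (suc (suc d)) | yes _ = suc d + k
  extra⁻¹ d | no _ = k ∸ suc (d ∸ (m + Rk))

  extra⁻¹-vtx : ∀ z → extra⁻¹ (m + (Rk + z)) ≡ k ∸ suc z
  extra⁻¹-vtx z with m + (Rk + z) <? m
  ... | yes p = ⊥-elim (<⇒≱ p (m≤m+n m _))
  ... | no _ = cong (λ q → k ∸ suc q) (trans (cong (_∸ (m + Rk)) (sym (+-assoc m Rk z))) (m+n∸m≡n (m + Rk) z))

  extra⁻¹-e : ∀ d → suc (suc d) < m → extra⁻¹ (suc (suc d)) ≡ suc d + k
  extra⁻¹-e d h with suc (suc d) <? m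
  ... | yes _ = refl
  ... | no ¬h = ⊥-elim (¬h h)

  ycase : ∀ y → y < k ⊎ y ≡ k ⊎ y ≡ suc k ⊎ suc (suc k) ≤ y
  ycase y with y <? k
  ... | yes p = inj₁ p
  ... | no p with m≤n⇒m<n∨m≡n (≮⇒≥ p)
  ... | inj₂ e = inj₂ (inj₁ (sym e))
  ... | inj₁ q with m≤n⇒m<n∨m≡n q
  ... | inj₂ e = inj₂ (inj₂ (inj₁ (sym e)))
  ... | inj₁ q' = inj₂ (inj₂ (inj₂ q'))

  extra⁻¹-extra : ∀ y → y < k + k → extra⁻¹ (extra y) ≡ y
  extra⁻¹-extra y h with ycase y
  ... | inj₁ p rewrite extra-<k y p = go (k ∸ y) refl
    where
    go : ∀ q → k ∸ y ≡ q → extra⁻¹ (vtx (Rk + q)) ≡ y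
    go zero e = ⊥-elim (<⇒≱ p (m∸n≡0⇒m≤n e))
    go (suc z) e = trans (cong extra⁻¹ (vtx-Rk+ z)) (trans (extra⁻¹-vtx z) (trans (cong (k ∸_) (sym e)) (m∸[m∸n]≡n (<⇒≤ p))))
  ... | inj₂ (inj₁ refl) rewrite extra-k = refl
  ... | inj₂ (inj₂ (inj₁ refl)) rewrite extra-1+k = refl
  ... | inj₂ (inj₂ (inj₂ q')) rewrite extra-≥2+k y q' = go (y ∸ k) refl
    where
    go : ∀ q → y ∸ k ≡ q → extra⁻¹ (suc q) ≡ y
    go zero e = ⊥-elim (<⇒≱ q' (≤-trans (m∸n≡0⇒m≤n e) (n≤1+n k)))
    go (suc d) e = trans (extra⁻¹-e d lt) (trans (cong (_+ k) (sym e)) (m∸n+n≡m (≤-trans (n≤1+n k) (<⇒≤ q'))))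
      where
      lt : suc (suc d) < m
      lt = s≤s (subst (_≤ k) (trans (+-∸-assoc 1 (≤-trans (n≤1+n k) (<⇒≤ q'))) (cong suc e)) (≤-trans (∸-monoˡ-≤ k h) (≤-reflexive (m+n∸n≡m k k))))

  extra-injective : ∀ y y' → y < k + k → y' < k + k → extra y ≡ extra y' → y ≡ y'
  extra-injective y y' h h' e = trans (sym (extra⁻¹-extra y h)) (trans (cong extra⁻¹ e) (extra⁻¹-extra y' h'))

  extra≢2 : ∀ y → y < k + k → extra y ≢ 2
  extra≢2 y h e with ycase y
  ... | inj₁ p rewrite extra-<k y p = go (k ∸ y) refl e
    where
    go : ∀ q → k ∸ y ≡ q → vtx (Rk + q) ≢ 2
    go zero e' = ⊥-elim (<⇒≱ p (m∸n≡0⇒m≤n e'))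
    go (suc z) _ e'' = <⇒≢ (≤-trans (s≤s (s≤s (s≤s z≤n))) (m≤m+n m (Rk + z))) (sym (trans (sym (vtx-Rk+ z)) e''))
  ... | inj₂ (inj₁ refl) rewrite extra-k = 1≢2 e
    where
    1≢2 : 1 ≢ 2
    1≢2 ()
  ... | inj₂ (inj₂ (inj₁ refl)) rewrite extra-1+k = 0≢2 e
    where
    0≢2 : 0 ≢ 2
    0≢2 ()
  ... | inj₂ (inj₂ (inj₂ q')) rewrite extra-≥2+k y q' = go (y ∸ k) refl e
    where
    go : ∀ q → y ∸ k ≡ q → suc q ≢ 2
    go (suc zero) e' _ = <⇒≱ q' (≤-reflexive (trans (sym (m∸n+n≡m (≤-trans (n≤1+n k) (<⇒≤ q')))) (cong (_+ k) e')))
    go zero e' _ = <⇒≱ q' (≤-trans (m∸n≡0⇒m≤n e') (n≤1+n k))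
    go (suc (suc _)) _ ()

  extra-<n : ∀ y → y < k + k → extra y < n
  extra-<n y h with ycase y
  ... | inj₁ p rewrite extra-<k y p = vtx-< (Rk + (k ∸ y)) ((r + s) * k)
        (≤-trans (+-monoʳ-≤ Rk (m∸n≤m k y)) (≤-trans (≤-reflexive (+-comm Rk k))
          (≤-trans (*-monoˡ-≤ k (≤-trans (m≤m+n (suc r) s0) (≤-reflexive (sym (+-suc r s0))))) ≤-refl)))
  ... | inj₂ (inj₁ refl) rewrite extra-k = <-trans (s≤s (s≤s z≤n)) m<n
  ... | inj₂ (inj₂ (inj₁ refl)) rewrite extra-1+k = <-trans (s≤s z≤n) m<n
  ... | inj₂ (inj₂ (inj₂ q')) rewrite extra-≥2+k y q' = ≤-<-trans (subst (_≤ k) (+-∸-assoc 1 (≤-trans (n≤1+n k) (<⇒≤ q'))) (≤-trans (∸-monoˡ-≤ k h) (≤-reflexive (m+n∸n≡m k k)))) (<-trans (n<1+n k) m<n)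

  extra-eps-to : ∀ y → y ≤ k → OnBranch 0 (extra y)
  extra-eps-to y h with ycase y
  ... | inj₁ p rewrite extra-<k y p = inj₂ (k ∸ y , refl , subst (_< k ∸ y) (n∸n≡0 y) (∸-monoˡ-< p ≤-refl) , z≤n , m∸n≤m k y)
  ... | inj₂ (inj₁ refl) rewrite extra-k = inj₁ (refl , refl)
  ... | inj₂ (inj₂ (inj₁ refl)) = ⊥-elim (<-irrefl refl h)
  ... | inj₂ (inj₂ (inj₂ q)) = ⊥-elim (<⇒≱ (≤-trans (n≤1+n (suc k)) q) h)

  extra-eps-from : ∀ d → OnBranch 0 d → ∃[ y ] y ≤ k × extra y ≡ d
  extra-eps-from d (inj₁ (refl , _)) = k , ≤-refl , extra-k
  extra-eps-from d (inj₂ (w , refl , w>0 , _ , h)) = k ∸ w , m∸n≤m k w ,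
    trans (extra-<k (k ∸ w) lt) (cong (λ q → vtx (Rk + q)) (m∸[m∸n]≡n h))
    where
    lt : k ∸ w < k
    lt = ∸-monoʳ-< w>0 h

  extra-e-to : ∀ y → k ≤ y → y < k + k → extra y < m
  extra-e-to y h1 h2 with ycase y
  ... | inj₁ p = ⊥-elim (<⇒≱ p h1)
  ... | inj₂ (inj₁ refl) rewrite extra-k = s≤s (s≤s z≤n)
  ... | inj₂ (inj₂ (inj₁ refl)) rewrite extra-1+k = s≤s z≤n
  ... | inj₂ (inj₂ (inj₂ q)) rewrite extra-≥2+k y q = s≤s (subst (_≤ k) (+-∸-assoc 1 (≤-trans (n≤1+n k) (<⇒≤ q))) (≤-trans (∸-monoˡ-≤ k h2) (≤-reflexive (m+n∸n≡m k k))))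

  extra-e-from : ∀ d → d < m → d ≢ 2 → ∃[ y ] k ≤ y × y < k + k × extra y ≡ d
  extra-e-from zero _ _ = suc k , n≤1+n k , subst (_< k + k) (+-comm k 1) (+-monoʳ-< k (s≤s (s≤s z≤n))) , extra-1+k
  extra-e-from (suc zero) _ _ = k , ≤-refl , m<m+n k (s≤s z≤n) , extra-k
  extra-e-from (suc (suc zero)) _ ne = ⊥-elim (ne refl)
  extra-e-from (suc (suc (suc d))) h _ = suc (suc d) + k , m≤n+m k (suc (suc d)) ,
    +-monoˡ-< k (s≤s⁻¹ h) ,
    trans (extra-≥2+k _ (+-monoˡ-≤ k (s≤s (s≤s z≤n)))) (cong suc (m+n∸n≡m (suc (suc d)) k))

-- Comparing the copies of P₃

MapsEdge-viaℕ : ∀ {V N} (ψ : Fin V → Fin N) (f : ℕ → ℕ) → (∀ y → toℕ (ψ y) ≡ f (toℕ y)) →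
  ∀ {e : Subset V} {e' : Subset N} {P Q : ℕ → Set} →
  (∀ y → y ∈ₛ e ⇔ P (toℕ y)) → (∀ x → x ∈ₛ e' ⇔ Q (toℕ x)) → (∀ c → P c → c < V) →
  MapsOnto f P Q → MapsEdge ψ e e'
MapsEdge-viaℕ ψ f ψ≗f {e} {e'} {P} {Q} e⇔P e'⇔Q P<V (to , from) x = onto , into
  where
  onto : x ∈ₛ e' → ∃[ y ] y ∈ₛ e × ψ y ≡ x
  onto x∈ with from (toℕ x) (proj₁ (e'⇔Q x) x∈)
  ... | c , Pc , fc≡x = fromℕ< (P<V c Pc) ,
        proj₂ (e⇔P _) (subst P (sym (toℕ-fromℕ< _)) Pc) ,
        toℕ-injective (trans (ψ≗f _) (trans (cong f (toℕ-fromℕ< _)) fc≡x))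
  into : (∃[ y ] y ∈ₛ e × ψ y ≡ x) → x ∈ₛ e'
  into (y , y∈ , refl) = proj₂ (e'⇔Q _) (subst Q (sym (ψ≗f y)) (to _ (proj₁ (e⇔P y) y∈)))

module Comparison (a r0 s0 : ℕ) where
  open Coordinates a r0 s0

  F : Hypergraph
  F = Path m 3

  -- H^e_{r,s} (edges As) and H^e_{r+s,0} (edges Bs) on a common vertex set: edge 0 is e,
  -- edges 1 … r + s are path edges, and the edges after them are attached ones, the same in both.
  record Layout : Set where
    field
      N : ℕ
      As Bs : List (Subset N)
      n≤N : n ≤ N
      length-Bs : length Bs ≡ length As
      1+r+s<length-As : suc (r + s) < length As
      A-e : ∀ j x → toℕ j ≡ 0 → x ∈ₛ edgeAt (hg N As) j ⇔ toℕ x < m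
      A-path : ∀ j x t → toℕ j ≡ suc t → t < r → x ∈ₛ edgeAt (hg N As) j ⇔ OnPath t (toℕ x)
      A-branch : ∀ j x t → toℕ j ≡ suc (r + t) → t < s → x ∈ₛ edgeAt (hg N As) j ⇔ OnBranch t (toℕ x)
      B-e : ∀ j x → toℕ j ≡ 0 → x ∈ₛ edgeAt (hg N Bs) j ⇔ toℕ x < m
      B-path : ∀ j x t → toℕ j ≡ suc t → t < r + s → x ∈ₛ edgeAt (hg N Bs) j ⇔ OnPath t (toℕ x)
      B-attached-base : ∀ j x → suc (r + s) ≤ toℕ j → x ∈ₛ edgeAt (hg N Bs) j → toℕ x < n → 2 ≤ toℕ x × toℕ x < m
      attached-A≡B : ∀ j j' → toℕ j ≡ toℕ j' → suc (r + s) ≤ toℕ j' → edgeAt (hg N As) j ≡ edgeAt (hg N Bs) j'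

  -- An attached edge of H^e_{r,s} through w₁ = 2: the image of a (k+1)-set f under an injective κ
  -- sending the vertex w̃ to w₁ and all other vertices beyond the vertices of the core.
  record AttachedEdge (L : Layout) : Set where
    open Layout L
    field
      index : Fin (length As)
      index-attached : suc (r + s) ≤ toℕ index
      N₀ : ℕ
      f : Subset N₀
      w̃ : Fin N₀
      κ : Fin N₀ → Fin N
      κ-injective : ∀ {z z'} → κ z ≡ κ z' → z ≡ z'
      κ-w̃ : toℕ (κ w̃) ≡ 2
      κ-other : ∀ {z} → z ≢ w̃ → n ≤ toℕ (κ z)
      edge≡κ[f] : ∀ x → x ∈ₛ edgeAt (hg N As) index ⇔ (∃[ z ] z ∈ₛ f × κ z ≡ x)
      enum : Enumeration f k w̃

  module _ (L : Layout) where
    open Layout L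

    A B : Hypergraph
    A = hg N As
    B = hg N Bs

    private
      eA : Fin (length As) → Subset N
      eA = edgeAt A
      eB : Fin (length Bs) → Subset N
      eB = edgeAt B

    A-index-cases : ∀ t → t ≡ 0 ⊎ (∃[ t' ] t ≡ suc t' × t' < r) ⊎ (∃[ t' ] t ≡ suc (r + t') × t' < s) ⊎ suc (r + s) ≤ t
    A-index-cases zero = inj₁ refl
    A-index-cases (suc t) with t <? r | t <? r + s
    ... | yes t<r | _ = inj₂ (inj₁ (t , refl , t<r))
    ... | no t≮r | yes t<r+s = inj₂ (inj₂ (inj₁ (t ∸ r , cong suc (sym (m+[n∸m]≡n (≮⇒≥ t≮r))) ,
                     +-cancelˡ-< r _ _ (subst (_< r + s) (sym (m+[n∸m]≡n (≮⇒≥ t≮r))) t<r+s))))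
    ... | no _ | no t≮r+s = inj₂ (inj₂ (inj₂ (s≤s (≮⇒≥ t≮r+s))))

    B-index-cases : ∀ t → t ≡ 0 ⊎ (∃[ t' ] t ≡ suc t' × t' < r + s) ⊎ suc (r + s) ≤ t
    B-index-cases zero = inj₁ refl
    B-index-cases (suc t) with t <? r + s
    ... | yes t<r+s = inj₂ (inj₁ (t , refl , t<r+s))
    ... | no t≮r+s = inj₂ (inj₂ (s≤s (≮⇒≥ t≮r+s)))

    private
      2≤length-As : 2 ≤ length As
      2≤length-As = ≤-trans (s≤s (s≤s z≤n)) (<⇒≤ 1+r+s<length-As)

    -- ε, the (r + 1)-st path edge of H^e_{r+s,0}, is its only edge missing from H^e_{r,s}.
    ε : Fin (length Bs)
    ε = fromℕ< (subst (suc r <_) (sym length-Bs) (≤-<-trans (s≤s (m≤m+n r s)) 1+r+s<length-As))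

    toℕ-ε : toℕ ε ≡ suc r
    toℕ-ε = toℕ-fromℕ< _

    ψ : Fin N → Fin N
    ψ y = fromℕ< (fold-< N n≤N (toℕ y) (toℕ<n y))

    toℕ-ψ : ∀ y → toℕ (ψ y) ≡ fold (toℕ y)
    toℕ-ψ y = toℕ-fromℕ< _

    σ : Fin (length Bs) → Fin (length As)
    σ j = fromℕ< (relabel-< (toℕ j) (length As) 2≤length-As (subst (toℕ j <_) length-Bs (toℕ<n j)))

    toℕ-σ : ∀ j → toℕ (σ j) ≡ relabel (toℕ j)
    toℕ-σ j = toℕ-fromℕ< _

    σ₀ : Fin (length Bs) → Fin (length As)
    σ₀ j = fromℕ< (subst (toℕ j <_) length-Bs (toℕ<n j))

    toℕ-σ₀ : ∀ j → toℕ (σ₀ j) ≡ toℕ j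
    toℕ-σ₀ j = toℕ-fromℕ< _

    σ₀-injective : ∀ {j j'} → σ₀ j ≡ σ₀ j' → j ≡ j'
    σ₀-injective {j} {j'} eq = toℕ-injective (trans (sym (toℕ-σ₀ j)) (trans (cong toℕ eq) (toℕ-σ₀ j')))

    unchanged : ∀ j → toℕ j ≢ suc r → MapsEdge id (eB j) (eA (σ₀ j))
    unchanged j j≢ε = MapsEdge-id eA⇔eB
      where
      eA⇔eB : ∀ x → x ∈ₛ eA (σ₀ j) ⇔ x ∈ₛ eB j
      eA⇔eB x with A-index-cases (toℕ j)
      ... | inj₁ j≡0 = ⇔-trans (A-e (σ₀ j) x (trans (toℕ-σ₀ j) j≡0)) (⇔-sym (B-e j x j≡0))
      ... | inj₂ (inj₁ (t , j≡ , t<r)) =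
        ⇔-trans (A-path (σ₀ j) x t (trans (toℕ-σ₀ j) j≡) t<r) (⇔-sym (B-path j x t j≡ (<-≤-trans t<r (m≤m+n r s))))
      ... | inj₂ (inj₂ (inj₁ (zero , j≡ , _))) = ⊥-elim (j≢ε (trans j≡ (cong suc (+-identityʳ r))))
      ... | inj₂ (inj₂ (inj₁ (suc t , j≡ , t<s))) =
        ⇔-trans (A-branch (σ₀ j) x (suc t) (trans (toℕ-σ₀ j) j≡) t<s)
          (⇔-trans (OnBranch⇒OnPath (suc t) (s≤s z≤n) (toℕ x) , OnPath⇒OnBranch (suc t) (s≤s z≤n) (toℕ x))
                   (⇔-sym (B-path j x (r + suc t) j≡ (+-monoʳ-< r t<s))))
      ... | inj₂ (inj₂ (inj₂ attached)) rewrite attached-A≡B (σ₀ j) j (toℕ-σ₀ j) attached = id , id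

    B-neighbours : ∀ {j j' x} t' → x ∈ₛ eB j → x ∈ₛ eB j' → toℕ j' ≡ suc t' → t' < r + s →
                   toℕ j ≤ r + s × toℕ j ≤ suc (toℕ j') × toℕ j' ≤ suc (toℕ j)
    B-neighbours {j} {j'} {x} t' x∈j x∈j' j'≡ t'<r+s with proj₁ (B-path j' x t' j'≡ t'<r+s) x∈j' | B-index-cases (toℕ j)
    ... | x∈t' | inj₁ j≡0 with OnPath-<m t' (toℕ x) x∈t' (proj₁ (B-e j x j≡0) x∈j)
    ...   | _ , refl rewrite j≡0 | j'≡ = z≤n , z≤n , s≤s z≤n
    B-neighbours {j} {j'} {x} t' x∈j x∈j' j'≡ t'<r+s | x∈t' | inj₂ (inj₁ (t , j≡ , t<r+s)) rewrite j≡ | j'≡ =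
      t<r+s , s≤s (OnPath-meet t t' (toℕ x) x∈t x∈t') , s≤s (OnPath-meet t' t (toℕ x) x∈t' x∈t)
      where
      x∈t : OnPath t (toℕ x)
      x∈t = proj₁ (B-path j x t j≡ t<r+s) x∈j
    -- An attached edge meets the core only in some w_i, and no w_i lies on the path.
    B-neighbours {j} {j'} {x} t' x∈j x∈j' j'≡ t'<r+s | x∈t' | inj₂ (inj₂ attached)
      with B-attached-base j x attached x∈j (OnPath-<n t' (toℕ x) t'<r+s x∈t')
    ... | 2≤x , x<m = ⊥-elim (<⇒≱ 2≤x (≤-trans (≤-reflexive (proj₁ (OnPath-<m t' (toℕ x) x∈t' x<m))) z≤n))

    module _ {W S} (W,S-copy : IsCopy F B (W , S)) (ε∈S : ε ∈ₛ S) where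

      -- Every edge of the copy meets an edge that meets ε.
      near-ε : ∀ {j} → j ∈ₛ S → NearEps (toℕ j)
      near-ε {j} j∈ with copy-linked m B W,S-copy j∈ ε∈S
      ... | j'' , _ , (x , x∈j , x∈j'') , (x' , x'∈j'' , x'∈ε)
        with B-neighbours r x'∈j'' x'∈ε toℕ-ε (m<m+n r (s≤s z≤n))
      ... | j''≤r+s , j''≤2+r , r≤j'' = via (toℕ j'') refl
        where
        j''≤ : toℕ j'' ≤ suc (suc r)
        j''≤ = subst (λ q → toℕ j'' ≤ suc q) toℕ-ε j''≤2+r
        ≤j'' : r ≤ toℕ j''
        ≤j'' = s≤s⁻¹ (subst (_≤ suc (toℕ j'')) toℕ-ε r≤j'')
        via : ∀ t → toℕ j'' ≡ t → NearEps (toℕ j)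
        via zero j''≡0 = ⊥-elim (<⇒≱ (s≤s z≤n) (subst (r ≤_) j''≡0 ≤j''))
        via (suc t) j''≡ with B-neighbours t x∈j x∈j'' j''≡ (subst (_≤ r + s) j''≡ j''≤r+s)
        ... | j≤r+s , j≤ , ≤j = s≤s⁻¹ (≤-trans ≤j'' ≤j) , ≤-trans j≤ (≤-trans (s≤s j''≤) (≤-reflexive (+-comm 3 r))) , j≤r+s

      in-FoldDomain : ∀ {y} → y ∈ₛ W → FoldDomain (toℕ y)
      in-FoldDomain {y} y∈ with copy-covered m B W,S-copy y∈
      ... | j , j∈ , y∈j with near-ε j∈ | B-index-cases (toℕ j)
      ... | (r0≤j , _ , _) | inj₁ j≡0 = inj₁ (n≤0⇒n≡0 (subst (r0 ≤_) j≡0 r0≤j) , proj₁ (B-e j y j≡0) y∈j)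
      ... | (r0≤j , _ , _) | inj₂ (inj₁ (t , j≡ , t<r+s)) =
        OnPath-FoldDomain t (toℕ y) (∸-monoˡ-≤ 1 (subst (r0 ≤_) j≡ r0≤j)) (proj₁ (B-path j y t j≡ t<r+s) y∈j)
      ... | (_ , _ , j≤r+s) | inj₂ (inj₂ attached) = ⊥-elim (<⇒≱ attached j≤r+s)

    folded : ∀ j → NearEps (toℕ j) → MapsEdge ψ (eB j) (eA (σ j))
    folded j near with NearEps-cases (toℕ j) near
    ... | inj₁ j≡r0 with r0 ℕ.≟ 0
    ...   | yes r0≡0 =
      MapsEdge-viaℕ ψ fold toℕ-ψ (λ y → B-e j y (trans j≡r0 r0≡0))
        (λ x → A-path (σ j) x 0 (trans (toℕ-σ j) (trans (cong relabel j≡r0) relabel-r0)) (s≤s z≤n))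
        (λ c c<m → <-≤-trans c<m (≤-trans (<⇒≤ m<n) n≤N)) (fold-e↠path₀ r0≡0)
    ...   | no r0≢0 =
      MapsEdge-viaℕ ψ fold toℕ-ψ (λ y → B-path j y r1 (trans j≡r0 (sym 1+r1≡r0)) r1<r+s)
        (λ x → A-path (σ j) x 0 (trans (toℕ-σ j) (trans (cong relabel j≡r0) relabel-r0)) (s≤s z≤n))
        (λ c c∈ → <-≤-trans (OnPath-<n r1 c r1<r+s c∈) n≤N)
        (fold-path↠path₀ r1 (trans (+-comm (r1 * k) k) (cong (_* k) 1+r1≡r0)))
      where
      r1 : ℕ
      r1 = ℕ.pred r0
      1+r1≡r0 : suc r1 ≡ r0
      1+r1≡r0 = suc-pred r0 {{≢-nonZero r0≢0}}
      r1<r+s : r1 < r + s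
      r1<r+s = ≤-trans (≤-reflexive 1+r1≡r0) (≤-trans (n≤1+n r0) (m≤m+n r s))
    folded j near | inj₂ (inj₁ j≡r) =
      MapsEdge-viaℕ ψ fold toℕ-ψ (λ y → B-path j y r0 j≡r (m≤m+n r s))
        (λ x → A-e (σ j) x (trans (toℕ-σ j) (trans (cong relabel j≡r) relabel-r)))
        (λ c c∈ → <-≤-trans (OnPath-<n r0 c (m≤m+n r s) c∈) n≤N) fold-path↠e
    folded j near | inj₂ (inj₂ r<j) =
      beyond (toℕ j ∸ suc r) j≡ (+-cancelˡ-< r _ _ (subst (_≤ r + s) j≡ (proj₂ (proj₂ near))))
      where
      j≡ : toℕ j ≡ suc (r + (toℕ j ∸ suc r))
      j≡ = sym (m+[n∸m]≡n r<j)
      σj≡j : toℕ (σ j) ≡ toℕ j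
      σj≡j = trans (toℕ-σ j) (relabel->r _ r<j)
      beyond : ∀ t → toℕ j ≡ suc (r + t) → t < s → MapsEdge ψ (eB j) (eA (σ j))
      beyond zero j≡1+r _ =
        MapsEdge-viaℕ ψ fold toℕ-ψ (λ y → B-path j y r (trans j≡1+r (cong suc (+-identityʳ r))) r<r+s)
          (λ x → A-branch (σ j) x 0 (trans σj≡j j≡1+r) (s≤s z≤n))
          (λ c c∈ → <-≤-trans (OnPath-<n r c r<r+s c∈) n≤N) fold-path↠branch₀
        where
        r<r+s : r < r + s
        r<r+s = m<m+n r (s≤s z≤n)
      beyond (suc t) j≡1+r+t t<s =
        MapsEdge-viaℕ ψ fold toℕ-ψ (λ y → B-path j y (r + suc t) j≡1+r+t (+-monoʳ-< r t<s))
          (λ x → A-branch (σ j) x (suc t) (trans σj≡j j≡1+r+t) t<s)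
          (λ c c∈ → <-≤-trans (OnPath-<n (r + suc t) c (+-monoʳ-< r t<s) c∈) n≤N) (fold-path↠branch (suc t) (s≤s z≤n))

    transfer : SubHG B → SubHG A
    transfer (W , S) with ε ∈? S
    ... | yes _ = image ψ W , image σ S
    ... | no _ = image id W , image σ₀ S

    private
      ∉⇒≢ε : ∀ {S : Subset (length Bs)} {j} → ¬ ε ∈ₛ S → j ∈ₛ S → toℕ j ≢ suc r
      ∉⇒≢ε {S} ε∉ j∈ j≡ = ε∉ (subst (_∈ₛ S) (toℕ-injective (trans j≡ (sym toℕ-ε))) j∈)

      ψ-injective : ∀ {W S} → IsCopy F B (W , S) → ε ∈ₛ S →
                    ∀ {y y'} → y ∈ₛ W → y' ∈ₛ W → ψ y ≡ ψ y' → y ≡ y'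
      ψ-injective copy ε∈ {y} {y'} y∈ y'∈ eq = toℕ-injective
        (fold-injective _ _ (in-FoldDomain copy ε∈ y∈) (in-FoldDomain copy ε∈ y'∈)
          (trans (sym (toℕ-ψ y)) (trans (cong toℕ eq) (toℕ-ψ y'))))

      σ-injective : ∀ {j j'} → NearEps (toℕ j) → NearEps (toℕ j') → σ j ≡ σ j' → j ≡ j'
      σ-injective {j} {j'} near near' eq = toℕ-injective
        (relabel-injective _ _ near near' (trans (sym (toℕ-σ j)) (trans (cong toℕ eq) (toℕ-σ j'))))

      σε≡σ₀ε : σ ε ≡ σ₀ ε
      σε≡σ₀ε = toℕ-injective (trans (toℕ-σ ε) (trans (cong relabel toℕ-ε)
                 (trans (relabel->r (suc r) (n<1+n r)) (trans (sym toℕ-ε) (sym (toℕ-σ₀ ε))))))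

      -- A folded copy still uses the edge σ ε, which no kept copy uses.
      folded≢kept : ∀ {S S'} → ε ∈ₛ S → ¬ ε ∈ₛ S' → image σ S ≢ image σ₀ S'
      folded≢kept {S} {S'} ε∈ ε∉ eq with ∈-image⁻ σ₀ S' (subst (σ ε ∈ₛ_) eq (∈-image⁺ σ S ε∈))
      ... | j' , j'∈ , σ₀j'≡σε = ε∉ (subst (_∈ₛ S') (σ₀-injective (trans σ₀j'≡σε σε≡σ₀ε)) j'∈)

    transfer-copy : ∀ {X} → IsCopy F B X → IsCopy F A (transfer X)
    transfer-copy {W , S} copy with ε ∈? S
    ... | yes ε∈ = IsCopy-map F B A ψ σ (ψ-injective copy ε∈) (λ j∈ → folded _ (near-ε copy ε∈ j∈)) copy
    ... | no ε∉ = IsCopy-map F B A id σ₀ (λ _ _ eq → eq) (λ j∈ → unchanged _ (∉⇒≢ε ε∉ j∈)) copy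

    transfer-injective : ∀ {X X'} → IsCopy F B X → IsCopy F B X' → transfer X ≡ transfer X' → X ≡ X'
    transfer-injective {W , S} {W' , S'} copy copy' eq with ε ∈? S | ε ∈? S'
    ... | yes ε∈ | yes ε∈' = cong₂ _,_
      (image-injective ψ (λ y → FoldDomain (toℕ y))
         (λ {y} {y'} p p' eq → toℕ-injective (fold-injective _ _ p p' (trans (sym (toℕ-ψ y)) (trans (cong toℕ eq) (toℕ-ψ y')))))
         (in-FoldDomain copy ε∈) (in-FoldDomain copy' ε∈') (cong proj₁ eq))
      (image-injective σ (λ j → NearEps (toℕ j)) σ-injective (near-ε copy ε∈) (near-ε copy' ε∈') (cong proj₂ eq))
    ... | no _ | no _ = cong₂ _,_
      (image-injective id (λ _ → Data.Unit.⊤) (λ _ _ eq → eq) (λ _ → tt) (λ _ → tt) (cong proj₁ eq))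
      (image-injective σ₀ (λ _ → Data.Unit.⊤) (λ _ _ → σ₀-injective) (λ _ → tt) (λ _ → tt) (cong proj₂ eq))
    ... | yes ε∈ | no ε∉' = ⊥-elim (folded≢kept ε∈ ε∉' (cong proj₂ eq))
    ... | no ε∉ | yes ε∈' = ⊥-elim (folded≢kept ε∈' ε∉ (sym (cong proj₂ eq)))

    module _ (E : AttachedEdge L) where
      open AttachedEdge E
      open Enumeration enum

      private
        V : ℕ
        V = suc (3 * k)

        3k≡2k+k : 3 * k ≡ k + k + k
        3k≡2k+k = trans (cong (k +_) (cong (k +_) (+-identityʳ k))) (sym (+-assoc k k k))

        vertex : ∀ c → c < k + k + suc k → Fin V
        vertex c c< = fromℕ< (subst (c <_) (cong suc (sym 3k≡2k+k)) (subst (c <_) (+-suc (k + k) k) c<))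

        toℕ-vertex : ∀ c c< → toℕ (vertex c c<) ≡ c
        toℕ-vertex c c< = toℕ-fromℕ< _

        1*k≡k : 1 * k ≡ k
        1*k≡k = +-identityʳ k

        2*k≡2k : 2 * k ≡ k + k
        2*k≡2k = cong (k +_) (+-identityʳ k)

      -- The extra copy of P₃: the path edge 0 goes to the first edge of the path at v, the middle
      -- edge to e, and the last edge to the attached edge f.
      ξ : Fin V → Fin N
      ξ y with toℕ y <? k + k
      ... | yes y<2k = fromℕ< (<-≤-trans (extra-<n (toℕ y) y<2k) n≤N)
      ... | no _ = κ (at (toℕ y ∸ (k + k)))

      private
        toℕ-ξ-low : ∀ y → toℕ y < k + k → toℕ (ξ y) ≡ extra (toℕ y)
        toℕ-ξ-low y y<2k with toℕ y <? k + k
        ... | yes _ = toℕ-fromℕ< _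
        ... | no y≮2k = ⊥-elim (y≮2k y<2k)

        ξ-high : ∀ y → k + k ≤ toℕ y → ξ y ≡ κ (at (toℕ y ∸ (k + k)))
        ξ-high y 2k≤y with toℕ y <? k + k
        ... | yes y<2k = ⊥-elim (<⇒≱ y<2k 2k≤y)
        ... | no _ = refl

        low-or-high : ∀ (y : Fin V) → toℕ y < k + k ⊎ k + k ≤ toℕ y
        low-or-high y with toℕ y <? k + k
        ... | yes y<2k = inj₁ y<2k
        ... | no y≮2k = inj₂ (≮⇒≥ y≮2k)

        toℕ-ξ-2k : ∀ y → toℕ y ≡ k + k → toℕ (ξ y) ≡ 2
        toℕ-ξ-2k y y≡2k = trans (cong toℕ (ξ-high y (≤-reflexive (sym y≡2k))))
          (trans (cong (λ i → toℕ (κ (at i))) (trans (cong (_∸ (k + k)) y≡2k) (n∸n≡0 (k + k))))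
                 (trans (cong (λ z → toℕ (κ z)) at-0) κ-w̃))

        ε-in-A : Fin (length As)
        ε-in-A = fromℕ< (≤-<-trans (s≤s (m≤m+n r s)) 1+r+s<length-As)

        toℕ-ε-in-A : toℕ ε-in-A ≡ suc (r + 0)
        toℕ-ε-in-A = trans (toℕ-fromℕ< _) (cong suc (sym (+-identityʳ r)))

        e-in-A : Fin (length As)
        e-in-A = fromℕ< (≤-trans (s≤s z≤n) 2≤length-As)

        toℕ-e-in-A : toℕ e-in-A ≡ 0
        toℕ-e-in-A = toℕ-fromℕ< _

      σξ : Fin (length (edges F)) → Fin (length As)
      σξ fzero = ε-in-A
      σξ (fsuc fzero) = e-in-A
      σξ (fsuc (fsuc fzero)) = index

      ξ-maps-edge₀ : MapsEdge ξ (pathEdge m 3 0) (eA ε-in-A)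
      ξ-maps-edge₀ x = onto , into
        where
        onto : x ∈ₛ eA ε-in-A → ∃[ y ] y ∈ₛ pathEdge m 3 0 × ξ y ≡ x
        onto x∈ with extra-eps-from (toℕ x) (proj₁ (A-branch ε-in-A x 0 toℕ-ε-in-A (s≤s z≤n)) x∈)
        ... | c , c≤k , extra-c≡x =
          y , ∈-pathEdge⁺ m 3 0 y z≤n (≤-trans (≤-reflexive y≡c) c≤k) ,
          toℕ-injective (trans (toℕ-ξ-low y y<2k) (trans (cong extra y≡c) extra-c≡x))
          where
          c< : c < k + k + suc k
          c< = ≤-trans (s≤s c≤k) (≤-trans (m≤n+m (suc k) k) (+-monoˡ-≤ (suc k) (m≤m+n k k)))
          y : Fin V
          y = vertex c c<
          y≡c : toℕ y ≡ c
          y≡c = toℕ-vertex c c<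
          y<2k : toℕ y < k + k
          y<2k = subst (_< k + k) (sym y≡c) (≤-<-trans c≤k (m<m+n k (s≤s z≤n)))
        into : (∃[ y ] y ∈ₛ pathEdge m 3 0 × ξ y ≡ x) → x ∈ₛ eA ε-in-A
        into (y , y∈ , refl) = proj₂ (A-branch ε-in-A (ξ y) 0 toℕ-ε-in-A (s≤s z≤n))
          (subst (OnBranch 0) (sym (toℕ-ξ-low y (≤-<-trans y≤k (m<m+n k (s≤s z≤n))))) (extra-eps-to (toℕ y) y≤k))
          where
          y≤k : toℕ y ≤ k
          y≤k = proj₂ (∈-pathEdge⁻ m 3 0 y y∈)

      ξ-maps-edge₁ : MapsEdge ξ (pathEdge m 3 1) (eA e-in-A)
      ξ-maps-edge₁ x = onto , into
        where
        onto : x ∈ₛ eA e-in-A → ∃[ y ] y ∈ₛ pathEdge m 3 1 × ξ y ≡ x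
        onto x∈ with toℕ x ℕ.≟ 2
        ... | yes x≡2 =
          y , ∈-pathEdge⁺ m 3 1 y (≤-trans (≤-reflexive 1*k≡k) (subst (k ≤_) (sym y≡2k) (m≤m+n k k)))
                                  (≤-reflexive (trans y≡2k (sym (cong (_+ k) 1*k≡k)))) ,
          toℕ-injective (trans (toℕ-ξ-2k y y≡2k) (sym x≡2))
          where
          c< : k + k < k + k + suc k
          c< = m<m+n (k + k) (s≤s z≤n)
          y : Fin V
          y = vertex (k + k) c<
          y≡2k : toℕ y ≡ k + k
          y≡2k = toℕ-vertex (k + k) c<
        ... | no x≢2 with extra-e-from (toℕ x) (proj₁ (A-e e-in-A x toℕ-e-in-A) x∈) x≢2
        ...   | c , k≤c , c<2k , extra-c≡x =
          y , ∈-pathEdge⁺ m 3 1 y (≤-trans (≤-reflexive 1*k≡k) (subst (k ≤_) (sym y≡c) k≤c))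
                                  (≤-trans (≤-reflexive y≡c) (≤-trans (<⇒≤ c<2k) (≤-reflexive (cong (_+ k) (sym 1*k≡k))))) ,
          toℕ-injective (trans (toℕ-ξ-low y (subst (_< k + k) (sym y≡c) c<2k)) (trans (cong extra y≡c) extra-c≡x))
          where
          c< : c < k + k + suc k
          c< = <-trans c<2k (m<m+n (k + k) (s≤s z≤n))
          y : Fin V
          y = vertex c c<
          y≡c : toℕ y ≡ c
          y≡c = toℕ-vertex c c<
        into : (∃[ y ] y ∈ₛ pathEdge m 3 1 × ξ y ≡ x) → x ∈ₛ eA e-in-A
        into (y , y∈ , refl) with ∈-pathEdge⁻ m 3 1 y y∈ | low-or-high y
        ... | k≤y , _ | inj₁ y<2k = proj₂ (A-e e-in-A (ξ y) toℕ-e-in-A)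
          (subst (_< m) (sym (toℕ-ξ-low y y<2k)) (extra-e-to (toℕ y) (subst (_≤ toℕ y) 1*k≡k k≤y) y<2k))
        ... | _ , y≤2k | inj₂ 2k≤y = proj₂ (A-e e-in-A (ξ y) toℕ-e-in-A)
          (subst (_< m) (sym (toℕ-ξ-2k y (≤-antisym (subst (toℕ y ≤_) (cong (_+ k) 1*k≡k) y≤2k) 2k≤y))) (s≤s (s≤s (s≤s z≤n))))

      ξ-maps-edge₂ : MapsEdge ξ (pathEdge m 3 2) (eA index)
      ξ-maps-edge₂ x = onto , into
        where
        onto : x ∈ₛ eA index → ∃[ y ] y ∈ₛ pathEdge m 3 2 × ξ y ≡ x
        onto x∈ with proj₁ (edge≡κ[f] x) x∈
        ... | z , z∈ , refl with at-onto z∈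
        ...   | i , i≤k , refl =
          y , ∈-pathEdge⁺ m 3 2 y (≤-trans (≤-reflexive 2*k≡2k) (subst (k + k ≤_) (sym y≡) (m≤m+n (k + k) i)))
                                  (subst (_≤ 2 * k + k) (sym y≡) (≤-trans (+-monoʳ-≤ (k + k) i≤k) (≤-reflexive (cong (_+ k) (sym 2*k≡2k))))) ,
          trans (ξ-high y (subst (k + k ≤_) (sym y≡) (m≤m+n (k + k) i)))
                (cong (λ i → κ (at i)) (trans (cong (_∸ (k + k)) y≡) (m+n∸m≡n (k + k) i)))
          where
          c< : k + k + i < k + k + suc k
          c< = +-monoʳ-< (k + k) (s≤s i≤k)
          y : Fin V
          y = vertex (k + k + i) c<
          y≡ : toℕ y ≡ k + k + i
          y≡ = toℕ-vertex (k + k + i) c<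
        into : (∃[ y ] y ∈ₛ pathEdge m 3 2 × ξ y ≡ x) → x ∈ₛ eA index
        into (y , y∈ , refl) with ∈-pathEdge⁻ m 3 2 y y∈
        ... | 2k≤y , y≤3k = proj₂ (edge≡κ[f] (ξ y))
          (at (toℕ y ∸ (k + k)) ,
           at-∈ (≤-trans (∸-monoˡ-≤ (k + k) (subst (toℕ y ≤_) (cong (_+ k) 2*k≡2k) y≤3k)) (≤-reflexive (m+n∸m≡n (k + k) k))) ,
           sym (ξ-high y (subst (_≤ toℕ y) 2*k≡2k 2k≤y)))

      ξ-maps : ∀ {j} → j ∈ₛ ⊤ → MapsEdge ξ (edgeAt F j) (eA (σξ j))
      ξ-maps {fzero} _ = ξ-maps-edge₀
      ξ-maps {fsuc fzero} _ = ξ-maps-edge₁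
      ξ-maps {fsuc (fsuc fzero)} _ = ξ-maps-edge₂

      private
        high≤k : ∀ (y : Fin V) → toℕ y ∸ (k + k) ≤ k
        high≤k y = ≤-trans (∸-monoˡ-≤ (k + k) (≤-trans (s≤s⁻¹ (toℕ<n y)) (≤-reflexive 3k≡2k+k))) (≤-reflexive (m+n∸m≡n (k + k) k))

        -- Only w₁ is shared by the two parts, and the low part avoids w₁ = 2.
        low≢high : ∀ {y y'} → toℕ y < k + k → k + k ≤ toℕ y' → ξ y ≢ ξ y'
        low≢high {y} {y'} y<2k 2k≤y' eq with at (toℕ y' ∸ (k + k)) ≟ w̃
        ... | yes at≡w̃ = extra≢2 (toℕ y) y<2k (trans (sym (toℕ-ξ-low y y<2k))
            (trans (cong toℕ eq) (trans (cong toℕ (ξ-high y' 2k≤y')) (trans (cong (λ z → toℕ (κ z)) at≡w̃) κ-w̃))))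
        ... | no at≢w̃ = <⇒≱ (subst (_< n) (sym (toℕ-ξ-low y y<2k)) (extra-<n (toℕ y) y<2k))
            (subst (n ≤_) (sym (trans (cong toℕ eq) (cong toℕ (ξ-high y' 2k≤y')))) (κ-other at≢w̃))

      ξ-injective : ∀ {y y'} → ξ y ≡ ξ y' → y ≡ y'
      ξ-injective {y} {y'} eq with low-or-high y | low-or-high y'
      ... | inj₁ y<2k | inj₁ y'<2k = toℕ-injective (extra-injective (toℕ y) (toℕ y') y<2k y'<2k
              (trans (sym (toℕ-ξ-low y y<2k)) (trans (cong toℕ eq) (toℕ-ξ-low y' y'<2k))))
      ... | inj₂ 2k≤y | inj₂ 2k≤y' =
        toℕ-injective (trans (sym (m∸n+n≡m 2k≤y)) (trans (cong (_+ (k + k)) high≡high') (m∸n+n≡m 2k≤y')))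
        where
        high≡high' : toℕ y ∸ (k + k) ≡ toℕ y' ∸ (k + k)
        high≡high' = at-injective (high≤k y) (high≤k y') (κ-injective (trans (sym (ξ-high y 2k≤y)) (trans eq (ξ-high y' 2k≤y'))))
      ... | inj₁ y<2k | inj₂ 2k≤y' = ⊥-elim (low≢high y<2k 2k≤y' eq)
      ... | inj₂ 2k≤y | inj₁ y'<2k = ⊥-elim (low≢high y'<2k 2k≤y (sym eq))

      Z : SubHG A
      Z = image ξ ⊤ , image σξ ⊤

      Z-copy : IsCopy F A Z
      Z-copy = IsCopy-map F F A ξ σξ (λ _ _ → ξ-injective) ξ-maps (IsCopy-self F)

      -- Z uses the edges e, σ ε and f; a folded copy lies near ε, a kept one avoids σ ε.
      Z-missed : ∀ {X} → IsCopy F B X → transfer X ≢ Z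
      Z-missed {W , S} copy eq with ε ∈? S
      ... | yes ε∈ with ∈-image⁻ σ S (subst (index ∈ₛ_) (sym (cong proj₂ eq)) (∈-image⁺ σξ ⊤ {fsuc (fsuc fzero)} ∈⊤))
      ...   | j , j∈ , σj≡index = <⇒≱ index-attached
              (≤-trans (≤-reflexive (trans (sym (cong toℕ σj≡index)) (toℕ-σ j))) (relabel-≤ _ (near-ε copy ε∈ j∈)))
      Z-missed {W , S} copy eq | no ε∉ with ∈-image⁻ σ₀ S (subst (ε-in-A ∈ₛ_) (sym (cong proj₂ eq)) (∈-image⁺ σξ ⊤ {fzero} ∈⊤))
      ...   | j , j∈ , σ₀j≡ = ∉⇒≢ε ε∉ j∈ (trans (sym (toℕ-σ₀ j)) (trans (cong toℕ σ₀j≡) (trans toℕ-ε-in-A (cong suc (+-identityʳ r)))))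

      copies-B<copies-A : length (copies B F) < length (copies A F)
      copies-B<copies-A = copies-< F A B transfer transfer-copy transfer-injective Z Z-copy Z-missed

-- The hypergraphs H^e_{r,s} and H^e_{r+s,0}

nth-just⇒< : ∀ (xs : List X) {i x} → nth xs i ≡ just x → i < length xs
nth-just⇒< (_ ∷ xs) {zero} _ = s≤s z≤n
nth-just⇒< (_ ∷ xs) {suc i} eq = s≤s (nth-just⇒< xs eq)

lookup-++-map : ∀ (P : X → Y) (E : List X) (Zs : List Y) (j : Fin (length (map P E ++ Zs))) {t e} →
                toℕ j ≡ t → nth E t ≡ just e → lookup (map P E ++ Zs) j ≡ P e
lookup-++-map P E Zs j {t} {e} j≡t nth≡e = just-injective (begin
  just (lookup (map P E ++ Zs) j) ≡⟨ sym (nth-lookup (map P E ++ Zs) j) ⟩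
  nth (map P E ++ Zs) (toℕ j)     ≡⟨ cong (nth (map P E ++ Zs)) j≡t ⟩
  nth (map P E ++ Zs) t           ≡⟨ nth-++ˡ (map P E) Zs (subst (t <_) (sym (length-map P E)) (nth-just⇒< E nth≡e)) ⟩
  nth (map P E) t                ≡⟨ nth-map P E t ⟩
  Maybe.map P (nth E t)          ≡⟨ cong (Maybe.map P) nth≡e ⟩
  just (P e)                     ∎)
  where open ≡-Reasoning

lookup-++ʳ : ∀ (Ys Zs : List X) (j : Fin (length (Ys ++ Zs))) {t} →
             toℕ j ≡ length Ys + t → just (lookup (Ys ++ Zs) j) ≡ nth Zs t
lookup-++ʳ Ys Zs j {t} j≡ = trans (sym (nth-lookup (Ys ++ Zs) j)) (trans (cong (nth (Ys ++ Zs)) j≡) (nth-++ʳ Ys Zs t))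

nth-map-map-upTo : ∀ (f : ℕ → X) (g : X → Y) {q t} → t < q → nth (map g (map f (upTo q))) t ≡ just (g (f t))
nth-map-map-upTo f g {q} {t} t<q = begin
  nth (map g (map f (upTo q))) t              ≡⟨ nth-map g (map f (upTo q)) t ⟩
  Maybe.map g (nth (map f (upTo q)) t)        ≡⟨ cong (Maybe.map g) (nth-map f (upTo q) t) ⟩
  Maybe.map g (Maybe.map f (nth (upTo q) t))  ≡⟨ cong (Maybe.map g ∘ Maybe.map f) (nth-applyUpTo id t<q) ⟩
  just (g (f t))                              ∎
  where open ≡-Reasoning

length-map-map-upTo : ∀ (f : ℕ → X) (g : X → Y) q → length (map g (map f (upTo q))) ≡ q
length-map-map-upTo f g q = trans (length-map g (map f (upTo q))) (trans (length-map f (upTo q)) (length-upTo q))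

∈-attachments : ∀ {p} (Hs : Fin p → Rooted) is {b R} → (b , R) ∈ₗ attachments Hs is → ∃[ i ] b ≡ posW i
∈-attachments Hs (i ∷ is) (here refl) = i , refl
∈-attachments Hs (i ∷ is) (there bR∈) = ∈-attachments Hs is bR∈

∣p∣≡1+k⇒Nonempty : ∀ {n k} (e : Subset n) → ∣ e ∣ ≡ suc k → Nonempty e
∣p∣≡1+k⇒Nonempty {n} e ∣e∣≡ with nonempty? e
... | yes ne = ne
... | no ¬ne = contradiction (trans (sym ∣e∣≡) (trans (cong ∣_∣ (Empty-unique ¬ne)) (∣⊥∣≡0 n))) λ ()

edge-through : ∀ {k} (G : Hypergraph) → Uniform (suc k) G → Connected G → HasEdge G →
               ∀ x → ∃[ f ] f ∈ₗ edges G × x ∈ₛ f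
edge-through G uniform connected (e , e∈) x with ∣p∣≡1+k⇒Nonempty e (All.lookup uniform e∈)
... | y , y∈e with connected x y
...   | Star.ε = e , e∈ , y∈e
...   | (f , f∈ , x∈f , _) Star.◅ _ = f , f∈ , x∈f

module Construction (a p' : ℕ) (p≤ : suc p' ≤ suc (suc (suc a)) ∸ 2) (Hs : Fin (suc p') → Rooted)
  (Hs-ok : ∀ i → Uniform (suc (suc (suc a))) (graph (Hs i)) × Simple (graph (Hs i)) ×
                 Connected (graph (Hs i)) × HasEdge (graph (Hs i)))
  (r0 s0 : ℕ) where

  open Coordinates a r0 s0
  open Comparison a r0 s0 using (Layout; AttachedEdge; A; B; copies-B<copies-A)

  p : ℕ
  p = suc p'

  3≤m : 3 ≤ m
  3≤m = s≤s (s≤s (s≤s z≤n))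

  u v : Fin m
  u = edgePos 3≤m p≤ posU
  v = edgePos 3≤m p≤ posV

  attached : List (EdgePos p × Rooted)
  attached = attachments Hs (allFin p)

  -- H^e_{r,s} and H^e_{r+s,0} before the H_i are attached, exactly as `Hers` computes them.
  nA : ℕ
  nA = m + r * k + s * k
  atU : Subset (suc (r * k)) → Subset (m + r * k)
  atU = image {suc (r * k)} {m + r * k} (glueMap {m} {suc (r * k)} u fzero)
  atV : Subset (suc (s * k)) → Subset (m + r * k + s * k)
  atV = image {suc (s * k)} {m + r * k + s * k} (glueMap {m + r * k} {suc (s * k)} (v ↑ˡ (r * k)) fzero)
  pathU : List (Subset (m + r * k))
  pathU = map atU (map (pathEdge m r) (upTo r))
  pathV : List (Subset nA)
  pathV = map atV (map (pathEdge m s) (upTo s))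
  EA : List (Subset nA)
  EA = map (pad {m + r * k} (s * k)) (pad {m} (r * k) ⊤ ∷ pathU) ++ pathV
  liftA : EdgePos p → Fin nA
  liftA b = (edgePos 3≤m p≤ b ↑ˡ (r * k)) ↑ˡ (s * k)

  nB : ℕ
  nB = m + (r + s) * k + 0
  atU' : Subset (suc ((r + s) * k)) → Subset (m + (r + s) * k)
  atU' = image {suc ((r + s) * k)} {m + (r + s) * k} (glueMap {m} {suc ((r + s) * k)} u fzero)
  atV' : Subset 1 → Subset (m + (r + s) * k + 0)
  atV' = image {1} {m + (r + s) * k + 0} (glueMap {m + (r + s) * k} {1} (v ↑ˡ ((r + s) * k)) fzero)
  pathU' : List (Subset (m + (r + s) * k))
  pathU' = map atU' (map (pathEdge m (r + s)) (upTo (r + s)))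
  EB : List (Subset nB)
  EB = map (pad {m + (r + s) * k} 0) (pad {m} ((r + s) * k) ⊤ ∷ pathU') ++ map atV' (map (pathEdge m 0) (upTo 0))
  liftB : EdgePos p → Fin nB
  liftB b = (edgePos 3≤m p≤ b ↑ˡ ((r + s) * k)) ↑ˡ 0

  nA≡nB : nA ≡ nB
  nA≡nB = trans (+-assoc m (r * k) (s * k)) (trans (cong (m +_) (sym (*-distribʳ-+ k r s))) (sym (+-identityʳ _)))

  n≡nA : n ≡ nA
  n≡nA = trans (cong (m +_) (*-distribʳ-+ k r s)) (sym (+-assoc m (r * k) (s * k)))

  toℕ-liftA≡liftB : ∀ b → toℕ (liftA b) ≡ toℕ (liftB b)
  toℕ-liftA≡liftB b = trans (toℕ-↑ˡ _ (s * k)) (trans (toℕ-↑ˡ _ (r * k)) (sym (trans (toℕ-↑ˡ _ 0) (toℕ-↑ˡ _ ((r + s) * k)))))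

  N : ℕ
  N = sizeAfter nA attached

  Xs : List (Subset N)
  Xs = newEdges nA liftA attached

  transportB : ∃[ pad' ] (∀ e x → x ∈ₛ pad' e ⇔ e ∋ℕ toℕ x) ×
               Hers m 3≤m p p≤ Hs (r + s) 0 ≡ hg N (map pad' EB ++ Xs)
  transportB = attachAll-transport nA nB nA≡nB liftA liftB toℕ-liftA≡liftB attached EB

  padB : Subset nB → Subset N
  padB = proj₁ transportB

  As Bs : List (Subset N)
  As = map (padAfter nA attached) EA ++ Xs
  Bs = map padB EB ++ Xs

  Hers-A : Hers m 3≤m p p≤ Hs r s ≡ hg N As
  Hers-A = attachAll-≡ nA EA liftA attached

  Hers-B : Hers m 3≤m p p≤ Hs (r + s) 0 ≡ hg N Bs
  Hers-B = proj₂ (proj₂ transportB)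

  private
    pathU-length : length (map (pad {m + r * k} (s * k)) pathU) ≡ r
    pathU-length = trans (length-map (pad (s * k)) pathU) (length-map-map-upTo (pathEdge m r) atU r)

  length-EA : length EA ≡ suc (r + s)
  length-EA = trans (length-++ (map (pad {m + r * k} (s * k)) (pad {m} (r * k) ⊤ ∷ pathU)) {pathV})
                    (cong suc (cong₂ _+_ pathU-length (length-map-map-upTo (pathEdge m s) atV s)))

  length-EB : length EB ≡ suc (r + s)
  length-EB = trans (length-++ (map (pad {m + (r + s) * k} 0) (pad {m} ((r + s) * k) ⊤ ∷ pathU')) {[]})
    (trans (+-identityʳ _) (cong suc (trans (length-map (pad 0) pathU') (length-map-map-upTo (pathEdge m (r + s)) atU' (r + s)))))

  length-As : length As ≡ suc (r + s) + length Xs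
  length-As = trans (length-++ (map (padAfter nA attached) EA)) (cong (_+ length Xs) (trans (length-map _ EA) length-EA))

  length-Bs : length Bs ≡ suc (r + s) + length Xs
  length-Bs = trans (length-++ (map padB EB)) (cong (_+ length Xs) (trans (length-map _ EB) length-EB))

  nth-EA-path : ∀ {t} → t < r → nth EA (suc t) ≡ just (pad (s * k) (atU (pathEdge m r t)))
  nth-EA-path {t} t<r =
    trans (nth-++ˡ (map (pad (s * k)) pathU) pathV (subst (t <_) (sym pathU-length) t<r))
          (trans (nth-map (pad (s * k)) pathU t) (cong (Maybe.map (pad (s * k))) (nth-map-map-upTo (pathEdge m r) atU t<r)))

  nth-EA-branch : ∀ {t} → t < s → nth EA (suc (r + t)) ≡ just (atV (pathEdge m s t))
  nth-EA-branch {t} t<s =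
    trans (cong (λ i → nth (map (pad (s * k)) pathU ++ pathV) (i + t)) (sym pathU-length))
          (trans (nth-++ʳ (map (pad (s * k)) pathU) pathV t) (nth-map-map-upTo (pathEdge m s) atV t<s))

  nth-EB-path : ∀ {t} → t < r + s → nth EB (suc t) ≡ just (pad 0 (atU' (pathEdge m (r + s) t)))
  nth-EB-path {t} t<r+s =
    trans (nth-++ˡ (map (pad 0) pathU') [] (subst (t <_) (sym (trans (length-map (pad 0) pathU') (length-map-map-upTo _ atU' (r + s)))) t<r+s))
          (trans (nth-map (pad 0) pathU' t) (cong (Maybe.map (pad 0)) (nth-map-map-upTo (pathEdge m (r + s)) atU' t<r+s)))

  gluedAtU⇔OnPath : ∀ t c → GluedPathEdge k m 0 t c ⇔ OnPath t c
  gluedAtU⇔OnPath t c = to , from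
    where
    to : GluedPathEdge k m 0 t c → OnPath t c
    to (inj₁ (refl , refl)) = 0 , refl , z≤n , z≤n
    to (inj₂ (z , refl , lo , hi)) = suc z , refl , lo , hi
    from : OnPath t c → GluedPathEdge k m 0 t c
    from (zero , refl , tk≤0 , _) = inj₁ (refl , m*n≡0⇒m≡0 t k (n≤0⇒n≡0 tk≤0))
    from (suc z , refl , lo , hi) = inj₂ (z , refl , lo , hi)

  gluedAtV⇔OnBranch : ∀ t c {v'} → v' ≡ 1 → GluedPathEdge k (m + r * k) v' t c ⇔ OnBranch t c
  gluedAtV⇔OnBranch t c refl = to , from
    where
    to : GluedPathEdge k (m + r * k) 1 t c → OnBranch t c
    to (inj₁ c≡1,t≡0) = inj₁ c≡1,t≡0
    to (inj₂ (z , refl , lo , hi)) = inj₂ (suc z , trans (+-assoc m (r * k) z) (sym (vtx-Rk+ z)) , s≤s z≤n , lo , hi)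
    from : OnBranch t c → GluedPathEdge k (m + r * k) 1 t c
    from (inj₁ c≡1,t≡0) = inj₁ c≡1,t≡0
    from (inj₂ (suc z , refl , _ , lo , hi)) = inj₂ (z , trans (vtx-Rk+ z) (sym (+-assoc m (r * k) z)) , lo , hi)

  private
    ∈-subst : ∀ {n} {e e' : Subset n} {x} {P : Set} → e ≡ e' → x ∈ₛ e' ⇔ P → x ∈ₛ e ⇔ P
    ∈-subst refl x∈⇔P = x∈⇔P

  A-e : ∀ j x → toℕ j ≡ 0 → x ∈ₛ lookup As j ⇔ toℕ x < m
  A-e j x j≡0 = ∈-subst (lookup-++-map (padAfter nA attached) EA Xs j j≡0 refl)
    (⇔-trans (∈-padAfter nA attached _ x) (⇔-trans (pad-∋ℕ (s * k) _ (toℕ x)) (⇔-trans (pad-∋ℕ (r * k) ⊤ (toℕ x)) (⊤-∋ℕ m (toℕ x)))))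

  A-path : ∀ j x t → toℕ j ≡ suc t → t < r → x ∈ₛ lookup As j ⇔ OnPath t (toℕ x)
  A-path j x t j≡ t<r = ∈-subst (lookup-++-map (padAfter nA attached) EA Xs j j≡ (nth-EA-path t<r))
    (⇔-trans (∈-padAfter nA attached _ x) (⇔-trans (pad-∋ℕ (s * k) _ (toℕ x))
      (⇔-trans (∋ℕ-gluedPathEdge k r t t<r u (toℕ x)) (gluedAtU⇔OnPath t (toℕ x)))))

  A-branch : ∀ j x t → toℕ j ≡ suc (r + t) → t < s → x ∈ₛ lookup As j ⇔ OnBranch t (toℕ x)
  A-branch j x t j≡ t<s = ∈-subst (lookup-++-map (padAfter nA attached) EA Xs j j≡ (nth-EA-branch t<s))
    (⇔-trans (∈-padAfter nA attached _ x)
      (⇔-trans (∋ℕ-gluedPathEdge k s t t<s (v ↑ˡ (r * k)) (toℕ x)) (gluedAtV⇔OnBranch t (toℕ x) (toℕ-↑ˡ v (r * k)))))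

  B-e : ∀ j x → toℕ j ≡ 0 → x ∈ₛ lookup Bs j ⇔ toℕ x < m
  B-e j x j≡0 = ∈-subst (lookup-++-map padB EB Xs j j≡0 refl)
    (⇔-trans (proj₁ (proj₂ transportB) _ x) (⇔-trans (pad-∋ℕ 0 _ (toℕ x)) (⇔-trans (pad-∋ℕ ((r + s) * k) ⊤ (toℕ x)) (⊤-∋ℕ m (toℕ x)))))

  B-path : ∀ j x t → toℕ j ≡ suc t → t < r + s → x ∈ₛ lookup Bs j ⇔ OnPath t (toℕ x)
  B-path j x t j≡ t<r+s = ∈-subst (lookup-++-map padB EB Xs j j≡ (nth-EB-path t<r+s))
    (⇔-trans (proj₁ (proj₂ transportB) _ x) (⇔-trans (pad-∋ℕ 0 _ (toℕ x))
      (⇔-trans (∋ℕ-gluedPathEdge k (r + s) t t<r+s u (toℕ x)) (gluedAtU⇔OnPath t (toℕ x)))))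

  private
    attached-index : ∀ (Y : List (Subset N)) {i} → length Y ≡ suc (r + s) →
                     suc (r + s) ≤ i → i ≡ length Y + (i ∸ suc (r + s))
    attached-index Y length-Y 1+r+s≤i = trans (sym (m+[n∸m]≡n 1+r+s≤i)) (cong (_+ _) (sym length-Y))

    length-A-base : length (map (padAfter nA attached) EA) ≡ suc (r + s)
    length-A-base = trans (length-map _ EA) length-EA

    length-B-base : length (map padB EB) ≡ suc (r + s)
    length-B-base = trans (length-map padB EB) length-EB

    lift-on-e : ∀ {b R} → (b , R) ∈ₗ attached → 2 ≤ toℕ (liftA b) × toℕ (liftA b) < m
    lift-on-e bR∈ with ∈-attachments Hs (allFin p) bR∈
    ... | i , refl = subst (λ c → 2 ≤ c × c < m) (sym (trans (toℕ-↑ˡ _ (s * k)) (toℕ-↑ˡ _ (r * k))))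
                           (s≤s (s≤s z≤n) , toℕ<n (edgePos 3≤m p≤ (posW i)))

  B-attached-base : ∀ j x → suc (r + s) ≤ toℕ j → x ∈ₛ lookup Bs j → toℕ x < n → 2 ≤ toℕ x × toℕ x < m
  B-attached-base j x attached-j x∈ x<n =
    newEdges-base (λ c → 2 ≤ c × c < m) nA liftA attached lift-on-e
      (nth⇒∈ Xs (toℕ j ∸ suc (r + s)) (sym (lookup-++ʳ (map padB EB) Xs j (attached-index (map padB EB) length-B-base attached-j))))
      x∈ (subst (toℕ x <_) n≡nA x<n)

  attached-A≡B : ∀ j j' → toℕ j ≡ toℕ j' → suc (r + s) ≤ toℕ j' → lookup As j ≡ lookup Bs j'
  attached-A≡B j j' j≡j' attached-j' = just-injective (trans
    (lookup-++ʳ (map (padAfter nA attached) EA) Xs j (trans j≡j' (attached-index (map (padAfter nA attached) EA) length-A-base attached-j')))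
    (sym (lookup-++ʳ (map padB EB) Xs j' (attached-index (map padB EB) length-B-base attached-j'))))

  H₁ : Rooted
  H₁ = Hs fzero
  N₁ : ℕ
  N₁ = nv (graph H₁)
  w̃₁ : Fin N₁
  w̃₁ = root H₁
  rest : List (EdgePos p × Rooted)
  rest = drop 1 attached
  ℓ₁ : Fin nA
  ℓ₁ = liftA (posW fzero)

  f₁-through-w̃₁ : ∃[ f ] f ∈ₗ edges (graph H₁) × w̃₁ ∈ₛ f
  f₁-through-w̃₁ = edge-through (graph H₁) (proj₁ (Hs-ok fzero)) (proj₁ (proj₂ (proj₂ (Hs-ok fzero))))
                                 (proj₂ (proj₂ (proj₂ (Hs-ok fzero)))) w̃₁
  f₁ : Subset N₁
  f₁ = proj₁ f₁-through-w̃₁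
  f₁∈ : f₁ ∈ₗ edges (graph H₁)
  f₁∈ = proj₁ (proj₂ f₁-through-w̃₁)
  w̃₁∈f₁ : w̃₁ ∈ₛ f₁
  w̃₁∈f₁ = proj₂ (proj₂ f₁-through-w̃₁)

  κ : Fin N₁ → Fin N
  κ z = injectAfter (nA + pred N₁) rest (glueMap ℓ₁ w̃₁ z)

  f₁-in-A : Subset N
  f₁-in-A = padAfter (nA + pred N₁) rest (image (glueMap ℓ₁ w̃₁) f₁)

  f₁-in-A∈Xs : f₁-in-A ∈ₗ Xs
  f₁-in-A∈Xs = ∈-++⁺ˡ (∈-map⁺ (padAfter (nA + pred N₁) rest) (∈-map⁺ (image (glueMap ℓ₁ w̃₁)) f₁∈))

  i₁ : ℕ
  i₁ = proj₁ (∈⇒nth f₁-in-A∈Xs)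

  index<length-As : suc (r + s) + i₁ < length As
  index<length-As = subst (suc (r + s) + i₁ <_) (sym length-As) (+-monoʳ-< (suc (r + s)) (proj₁ (proj₂ (∈⇒nth f₁-in-A∈Xs))))

  index : Fin (length As)
  index = fromℕ< index<length-As

  lookup-As-index : lookup As index ≡ f₁-in-A
  lookup-As-index = just-injective (trans
    (lookup-++ʳ (map (padAfter nA attached) EA) Xs index (trans (toℕ-fromℕ< index<length-As) (cong (_+ i₁) (sym length-A-base))))
    (proj₂ (proj₂ (∈⇒nth f₁-in-A∈Xs))))

  ∈-index⇔κ[f₁] : ∀ x → x ∈ₛ lookup As index ⇔ (∃[ z ] z ∈ₛ f₁ × κ z ≡ x)
  ∈-index⇔κ[f₁] x = ∈-subst lookup-As-index (to , from)
    where
    to : x ∈ₛ f₁-in-A → ∃[ z ] z ∈ₛ f₁ × κ z ≡ x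
    to x∈ with ∈-padAfter⁻ _ rest _ x∈
    ... | y , y∈ , refl with ∈-image⁻ (glueMap ℓ₁ w̃₁) f₁ y∈
    ...   | z , z∈ , refl = z , z∈ , refl
    from : (∃[ z ] z ∈ₛ f₁ × κ z ≡ x) → x ∈ₛ f₁-in-A
    from (z , z∈ , refl) = ∈-padAfter⁺ _ rest (∈-image⁺ (glueMap ℓ₁ w̃₁) f₁ z∈)

  layout : Layout
  layout = record
    { N = N
    ; As = As
    ; Bs = Bs
    ; n≤N = subst (_≤ N) (sym n≡nA) (sizeAfter-≥ nA attached)
    ; length-Bs = trans length-Bs (sym length-As)
    ; 1+r+s<length-As = ≤-<-trans (m≤m+n (suc (r + s)) i₁) index<length-As
    ; A-e = A-e
    ; A-path = A-path
    ; A-branch = A-branch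
    ; B-e = B-e
    ; B-path = B-path
    ; B-attached-base = B-attached-base
    ; attached-A≡B = attached-A≡B
    }

  attachedEdge : AttachedEdge layout
  attachedEdge = record
    { index = index
    ; index-attached = subst (suc (r + s) ≤_) (sym (toℕ-fromℕ< index<length-As)) (m≤m+n (suc (r + s)) i₁)
    ; N₀ = N₁
    ; f = f₁
    ; w̃ = w̃₁
    ; κ = κ
    ; κ-injective = λ eq → glueMap-injective ℓ₁ w̃₁ (toℕ-injective
        (trans (sym (toℕ-injectAfter _ rest _)) (trans (cong toℕ eq) (toℕ-injectAfter _ rest _))))
    ; κ-w̃ = trans (toℕ-injectAfter _ rest _) (trans (toℕ-glueMap-root ℓ₁ w̃₁)
              (trans (toℕ-↑ˡ (edgePos 3≤m p≤ (posW fzero) ↑ˡ (r * k)) (s * k)) (toℕ-↑ˡ (edgePos 3≤m p≤ (posW fzero)) (r * k))))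
    ; κ-other = λ {z} z≢w̃ → subst (_≤ toℕ (κ z)) (sym n≡nA)
        (subst (nA ≤_) (sym (toℕ-injectAfter _ rest _)) (toℕ-glueMap-other ℓ₁ w̃₁ (z≢w̃ ∘ sym)))
    ; edge≡κ[f] = ∈-index⇔κ[f₁]
    ; enum = enumeration f₁ (All.lookup (proj₁ (Hs-ok fzero)) f₁∈) w̃₁∈f₁
    }

lemma3p4 : (m : ℕ) → (3≤m : 3 ≤ m) → (p : ℕ) → 1 ≤ p → (p≤ : p ≤ m ∸ 2) →
    (Hs : Fin p → Rooted) →
    (∀ i → Uniform m (graph (Hs i)) × Simple (graph (Hs i)) ×
           Connected (graph (Hs i)) × HasEdge (graph (Hs i))) →
    (r s : ℕ) → s ≤ r → 1 ≤ s →
    Σ ℕ λ a → Σ ℕ λ b →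
      NumCopies (Hers m 3≤m p p≤ Hs r s) (Path m 3) a ×
      NumCopies (Hers m 3≤m p p≤ Hs (r + s) 0) (Path m 3) b ×
      b < a
lemma3p4 .(3 + a) (s≤s (s≤s (s≤s (z≤n {a})))) .(suc p') (s≤s (z≤n {p'})) p≤ Hs Hs-ok
         .(suc r0) .(suc s0) (s≤s {s0} {r0} _) _ =
  length (copies (A layout) F) , length (copies (B layout) F) ,
  subst (λ H → NumCopies H F (length (copies (A layout) F))) (sym Hers-A) (numCopies (A layout) F) ,
  subst (λ H → NumCopies H F (length (copies (B layout) F))) (sym Hers-B) (numCopies (B layout) F) ,
  copies-B<copies-A layout attachedEdge
  where
  open Construction a p' p≤ Hs Hs-ok r0 s0
  open Comparison a r0 s0 using (F; A; B; copies-B<copies-A)
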